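{- Let $d\ge 1$ and $n\ge 1$ be integers. Let $i,j$ be nonnegative integers, let $k$ be a nonnegative integer that is a multiple of $d$, and let $\ell$ be a positive integer. Write $i+j+k=\alpha d+\beta$ with $\alpha,\beta$ nonnegative integers and $0\le\beta<d$. Then the total number of pairs $(T,v)$ satisfying the conditions below equals $$d^{\ell}\left(1-\frac{\beta}{d}\cdot\frac{dn+\ell}{(d+1)n-\alpha}\right)\binom{(d+1)n-\alpha}{dn+\ell}.$$ The conditions are: $T$ is a rooted $d$-tuplet tree with $n$ tuplets, and $v$ is a vertex of $T$ such that <ul> <li>$v$ has at least $i$ elder siblings;</li> <li>$v$ has at least $j$ younger siblings;</li> <li>$v$ has at least $k$ children;</li> <li>$v$ is at level $\ge\ell$.</li> </ul>
   Context: A rooted $d$-tuplet tree is the following recursively defined ordered structure. It has a distinguished vertex, the root. Each vertex $u$ has a (possibly empty) linearly ordered list of tuplets attached below it. Each tuplet attached at $u$ consists of $u$ together with a linearly ordered list of exactly $d$ new vertices, the children of $u$ in that tuplet, each of which is again the top of such a structure. Equivalently, it is a rooted plane tree in which the children of every vertex are grouped, left to right, into consecutive blocks of size $d$. The number of tuplets is the total number of such blocks. For a non-root vertex $v$, the parent of $v$ is the vertex $u$ of the tuplet containing $v$ below $u$, and $v$ is a child of $u$. Vertices with the same parent are siblings; they are linearly ordered left to right over all tuplets of the parent, and within each tuplet. If a sibling $w$ of $v$ lies to the left of $v$, then $w$ is an elder sibling of $v$; if it lies to the right, it is a younger sibling. The number of children of $v$ is $d$ times the number of tuplets attached below $v$.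 The level of $v$ is the number of tuplets on the path from the root to $v$. -}

module Defs where

open import Data.Nat using (ℕ; zero; suc; _+_; _*_; _∸_; _^_; _≤_; NonZero)
open import Data.Nat.Combinatorics using (_C_)
open import Data.Fin using (Fin; toℕ)
open import Data.List using (List; []; _∷_; length)
import Data.List as List
open import Data.Vec using (Vec)
import Data.Vec as Vec
open import Data.Integer using (+_)
open import Relation.Binary.PropositionalEquality using (_≡_)
open import Data.Rational using (ℚ; 0ℚ; 1ℚ; _/_; _-_)
import Data.Rational as ℚ

-- Rooted d-tuplet trees: a vertex carries an ordered list of tuplets,
-- each tuplet an ordered vector of exactly d child subtrees.
data Tree (d : ℕ) : Set where
  node : List (Vec (Tree d) d) → Tree d

tuplets  : ∀ {d} → Tree d → ℕ
tupletsL : ∀ {d} → List (Vec (Tree d) d) → ℕ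
tupletsV : ∀ {d m} → Vec (Tree d) m → ℕ
tuplets (node ts) = length ts + tupletsL ts
tupletsL [] = 0
tupletsL (v ∷ vs) = tupletsV v + tupletsL vs
tupletsV Vec.[] = 0
tupletsV (t Vec.∷ ts) = tuplets t + tupletsV ts

data Vertex {d : ℕ} : Tree d → Set where
  root  : ∀ {t} → Vertex t
  below : ∀ {ts} (a : Fin (length ts)) (b : Fin d) →
          Vertex (Vec.lookup (List.lookup ts a) b) → Vertex (node ts)

subtree : ∀ {d} {t : Tree d} → Vertex t → Tree d
subtree {t = t} root = t
subtree (below a b v) = subtree v

children : ∀ {d} {t : Tree d} → Vertex t → ℕ
children {d} v with subtree v
... | node ts = d * length ts

level : ∀ {d} {t : Tree d} → Vertex t → ℕ
level root = 0
level (below a b v) = suc (level v)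

-- number of elder / younger siblings, computed from the last step of the
-- path (the root has no siblings; its counts are 0).  The accumulator holds
-- the value for the most recently visited step.
elderAux : ∀ {d} {t : Tree d} → ℕ → Vertex t → ℕ
elderAux acc root = acc
elderAux {d} acc (below a b v) = elderAux (toℕ a * d + toℕ b) v

elder : ∀ {d} {t : Tree d} → Vertex t → ℕ
elder = elderAux 0

youngerAux : ∀ {d} {t : Tree d} → ℕ → Vertex t → ℕ
youngerAux acc root = acc
youngerAux {d} {node ts} acc (below a b v) =
  youngerAux (length ts * d ∸ suc (toℕ a * d + toℕ b)) v

younger : ∀ {d} {t : Tree d} → Vertex t → ℕ
younger = youngerAux 0

record Pair (d n i j k ℓ : ℕ) : Set where
  constructor pair
  field
    T       : Tree d
    size    : tuplets T ≡ n
    v       : Vertex T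
    elderOK   : i ≤ elder v
    youngerOK : j ≤ younger v
    childOK   : k ≤ children v
    levelOK   : ℓ ≤ level v

-- d^ℓ (1 - (β/d)(dn+ℓ)/((d+1)n-α)) binom((d+1)n-α, dn+ℓ),
-- with the convention binom(m, r) = 0 when m < r (in particular when m ≤ 0).
formula : (d n ℓ α β : ℕ) → .{{NonZero d}} → ℚ
formula d n ℓ α β with suc d * n ∸ α
... | zero = 0ℚ
... | suc m' =
  ((+ (d ^ ℓ)) / 1)
  ℚ.* (1ℚ - ((+ β) / d) ℚ.* ((+ (d * n + ℓ)) / suc m'))
  ℚ.* ((+ (suc m' C (d * n + ℓ))) / 1)

-- Cut the tree at v: what remains is the subtree at v and the list of frames on the path from v
-- to the root, each frame recording the tuplets before and after the current one, the position in
-- it and the siblings there. Level ≥ ℓ bounds the number of frames and children ≥ k the number of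
-- tuplets at v; writing i = i₁ d + i₀ and j = j₁ d + j₀, the sibling conditions say that for the
-- position b of v there are at least i₁ + [b < i₀] tuplets before and j₁ + [d − 1 − b < j₀] after
-- its tuplet. Splitting off the forced parts of these lists and re-encoding each list of tuplets
-- as a single tree turns the data into d^(ℓ−1) choices of positions and a forest of trees followed
-- by a list of frames. Peeling one tuplet off the first tree shows that such framed forests with
-- r trees and m tuplets are counted by C((d+1)m + r − 1, m), so a position forcing E tuplets
-- contributes d^(ℓ−1) C((d+1)n − E, dn + ℓ). Over the d positions E equals α for d − β of them
-- and α + 1 for the other β, and C(M − 1, P) = (1 − P/M) C(M, P) gives the formula.

module Submission where

open import Data.Nat using (ℕ)

module Counting where

  open import Data.Nat using (ℕ; zero; suc; _+_; _*_; _^_; _<_; s≤s)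
  open import Data.Nat.Properties using (≡-irrelevant; suc-injective)
  open import Data.Fin using (Fin; zero; suc; toℕ)
  open import Data.Fin.Properties using (+↔⊎; *↔×; 1↔⊤)
  open import Data.Product using (Σ; _×_; _,_)
  open import Data.Product.Algebra using (×-cong)
  open import Data.Sum using (_⊎_; inj₁; inj₂; [_,_]′)
  open import Data.Sum.Algebra using (⊎-cong)
  open import Data.Unit using (⊤; tt)
  open import Data.Empty using (⊥-elim)
  open import Data.Vec using (Vec; []; _∷_)
  open import Function.Bundles using (_↔_; Inverse; mk↔ₛ′)
  open import Function.Properties.Inverse using (↔-refl; ↔-sym; ↔-trans)
  open import Relation.Nullary using (¬_)
  import Relation.Unary as U
  open import Relation.Binary.PropositionalEquality

  open Inverse

  private variable
    A B : Set
    m n : ℕ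

  Σ-≡-irrelevant : {P : A → Set} → U.Irrelevant P → {a a′ : A} {p : P a} {p′ : P a′} →
                   a ≡ a′ → _≡_ {A = Σ A P} (a , p) (a′ , p′)
  Σ-≡-irrelevant irr refl = cong (_ ,_) (irr _ _)

  Σ-subset-↔ : (e : A ↔ B) {P : A → Set} {Q : B → Set} → U.Irrelevant P → U.Irrelevant Q →
               (∀ {a} → P a → Q (to e a)) → (∀ {b} → Q b → P (from e b)) → Σ A P ↔ Σ B Q
  Σ-subset-↔ e irrP irrQ P⇒Q Q⇒P = mk↔ₛ′
    (λ (a , p) → to e a , P⇒Q p) (λ (b , q) → from e b , Q⇒P q)
    (λ (b , _) → Σ-≡-irrelevant irrQ (strictlyInverseˡ e b))
    (λ (a , _) → Σ-≡-irrelevant irrP (strictlyInverseʳ e a))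

  Fibre : (A → ℕ) → ℕ → Set
  Fibre {A} s m = Σ A λ a → s a ≡ m

  size-law-from : (e : A ↔ B) {s : A → ℕ} {t : B → ℕ} → (∀ b → s (from e b) ≡ t b) → ∀ a → s a ≡ t (to e a)
  size-law-from e {s} law a = trans (cong s (sym (strictlyInverseʳ e a))) (law (to e a))

  Σ-pullback-↔ : (e : A ↔ B) {P : A → Set} → U.Irrelevant P → Σ A P ↔ Σ B (λ b → P (from e b))
  Σ-pullback-↔ e {P} irr = Σ-subset-↔ e irr irr (λ {a} p → subst P (sym (strictlyInverseʳ e a)) p) (λ q → q)

  fibre-↔ : (e : A ↔ B) {s : A → ℕ} {t : B → ℕ} → (∀ a → s a ≡ t (to e a)) →
            Fibre s m ↔ Fibre t m
  fibre-↔ e {s} {t} s≡t = Σ-subset-↔ e ≡-irrelevant ≡-irrelevant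
    (λ {a} sa≡m → trans (sym (s≡t a)) sa≡m)
    (λ {b} tb≡m → trans (s≡t (from e b)) (trans (cong t (strictlyInverseˡ e b)) tb≡m))

  fibre-⊎ : {s : A → ℕ} {t : B → ℕ} → Fibre [ s , t ]′ m ↔ (Fibre s m ⊎ Fibre t m)
  fibre-⊎ = mk↔ₛ′
    (λ { (inj₁ a , p) → inj₁ (a , p) ; (inj₂ b , p) → inj₂ (b , p) })
    (λ { (inj₁ (a , p)) → inj₁ a , p ; (inj₂ (b , p)) → inj₂ b , p })
    (λ { (inj₁ _) → refl ; (inj₂ _) → refl })
    (λ { (inj₁ _ , _) → refl ; (inj₂ _ , _) → refl })

  fibre-suc : {s : A → ℕ} → Fibre (λ a → suc (s a)) (suc m) ↔ Fibre s m
  fibre-suc = Σ-subset-↔ ↔-refl ≡-irrelevant ≡-irrelevant suc-injective (cong suc)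

  empty-↔ : ¬ A → A ↔ Fin 0
  empty-↔ ¬a = mk↔ₛ′ (λ a → ⊥-elim (¬a a)) (λ ()) (λ ()) (λ a → ⊥-elim (¬a a))

  count-cong : m ≡ n → A ↔ Fin m → A ↔ Fin n
  count-cong refl e = e

  ⊎-count : A ↔ Fin m → B ↔ Fin n → (A ⊎ B) ↔ Fin (m + n)
  ⊎-count e f = ↔-trans (⊎-cong e f) (↔-sym +↔⊎)

  ×-count : A ↔ Fin m → B ↔ Fin n → (A × B) ↔ Fin (m * n)
  ×-count e f = ↔-trans (×-cong e f) (↔-sym *↔×)

  Vec-zero-↔ : Vec A zero ↔ ⊤
  Vec-zero-↔ = mk↔ₛ′ (λ _ → tt) (λ _ → []) (λ _ → refl) (λ { [] → refl })

  Vec-suc-↔ : Vec A (suc n) ↔ (A × Vec A n)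
  Vec-suc-↔ = mk↔ₛ′ (λ { (x ∷ xs) → x , xs }) (λ (x , xs) → x ∷ xs) (λ _ → refl) (λ { (_ ∷ _) → refl })

  Vec-count : A ↔ Fin m → ∀ n → Vec A n ↔ Fin (m ^ n)
  Vec-count e zero    = ↔-trans Vec-zero-↔ (↔-sym 1↔⊤)
  Vec-count e (suc n) = ↔-trans Vec-suc-↔ (×-count e (Vec-count e n))

  sumBelow : ℕ → (ℕ → ℕ) → ℕ
  sumBelow zero    f = 0
  sumBelow (suc n) f = f 0 + sumBelow n (λ c → f (suc c))

  ΣFin-count : ∀ n {B : Fin n → Set} (f : ℕ → ℕ) → (∀ b → B b ↔ Fin (f (toℕ b))) →
               Σ (Fin n) B ↔ Fin (sumBelow n f)
  ΣFin-count zero    f count = empty-↔ λ ()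
  ΣFin-count (suc n) {B} f count = ↔-trans split (⊎-count (count zero) (ΣFin-count n (λ c → f (suc c)) (λ b → count (suc b))))
    where
    split : Σ (Fin (suc n)) B ↔ (B zero ⊎ Σ (Fin n) (λ b → B (suc b)))
    split = mk↔ₛ′ (λ { (zero , x) → inj₁ x ; (suc b , x) → inj₂ (b , x) })
                  (λ { (inj₁ x) → zero , x ; (inj₂ (b , x)) → suc b , x })
                  (λ { (inj₁ _) → refl ; (inj₂ _) → refl })
                  (λ { (zero , _) → refl ; (suc _ , _) → refl })

  shifted : (ℕ → ℕ) → ℕ → ℕ → ℕ
  shifted f zero    n       = f n
  shifted f (suc c) zero    = 0
  shifted f (suc c) (suc n) = shifted f c n

  shifted-+ : ∀ f c t → shifted f c (c + t) ≡ f t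
  shifted-+ f zero    t = refl
  shifted-+ f (suc c) t = shifted-+ f c t

  shifted-< : ∀ f {c n} → n < c → shifted f c n ≡ 0
  shifted-< f {suc c} {zero}  _         = refl
  shifted-< f {suc c} {suc n} (s≤s n<c) = shifted-< f n<c

  fibre-shifted-count : {s : A → ℕ} {f : ℕ → ℕ} → (∀ m → Fibre s m ↔ Fin (f m)) →
                        ∀ c n → Fibre (λ a → c + s a) n ↔ Fin (shifted f c n)
  fibre-shifted-count count zero    n       = count n
  fibre-shifted-count count (suc c) zero    = empty-↔ λ ()
  fibre-shifted-count count (suc c) (suc n) = ↔-trans fibre-suc (fibre-shifted-count count c n)

module Pointed where

  open import Data.Nat using (ℕ; suc)
  open import Data.Fin using (Fin; zero; suc; toℕ)
  open import Data.List using (List; []; _∷_; length; _++_)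
  import Data.List as List
  open import Data.Vec using (Vec; _∷_; removeAt)
  import Data.Vec as Vec
  open import Data.Product using (Σ; _×_; _,_)
  open import Function.Bundles using (_↔_; mk↔ₛ′)
  open import Relation.Binary.PropositionalEquality

  module _ {X : Set} where

    prefix : (xs : List X) → Fin (length xs) → List X
    prefix (x ∷ xs) zero    = []
    prefix (x ∷ xs) (suc a) = x ∷ prefix xs a

    suffix : (xs : List X) → Fin (length xs) → List X
    suffix (x ∷ xs) zero    = xs
    suffix (x ∷ xs) (suc a) = suffix xs a

    length-prefix : (xs : List X) (a : Fin (length xs)) → length (prefix xs a) ≡ toℕ a
    length-prefix (x ∷ xs) zero    = refl
    length-prefix (x ∷ xs) (suc a) = cong suc (length-prefix xs a)

    prefix-lookup-suffix : (xs : List X) (a : Fin (length xs)) →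
                           prefix xs a ++ List.lookup xs a ∷ suffix xs a ≡ xs
    prefix-lookup-suffix (x ∷ xs) zero    = refl
    prefix-lookup-suffix (x ∷ xs) (suc a) = cong (x ∷_) (prefix-lookup-suffix xs a)

    PointedList : (X → Set) → Set
    PointedList Q = Σ (List X) λ xs → Σ (Fin (length xs)) λ a → Q (List.lookup xs a)

    pointedList-↔ : (Q : X → Set) → PointedList Q ↔ (List X × List X × Σ X Q)
    pointedList-↔ Q = mk↔ₛ′ split insert split-insert insert-split
      where
      split : PointedList Q → List X × List X × Σ X Q
      split (xs , a , q) = prefix xs a , suffix xs a , List.lookup xs a , q

      cons : X → PointedList Q → PointedList Q
      cons y (xs , a , q) = y ∷ xs , suc a , q

      insert : List X × List X × Σ X Q → PointedList Q
      insert ([]     , zs , x , q) = x ∷ zs , zero , q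
      insert (y ∷ ys , zs , p)     = cons y (insert (ys , zs , p))

      split-insert : ∀ c → split (insert c) ≡ c
      split-insert ([]     , zs , p) = refl
      split-insert (y ∷ ys , zs , p) = cong (λ (ys′ , c) → y ∷ ys′ , c) (split-insert (ys , zs , p))

      insert-split : ∀ r → insert (split r) ≡ r
      insert-split (x ∷ xs , zero  , q) = refl
      insert-split (x ∷ xs , suc a , q) = cong (cons x) (insert-split (xs , a , q))

    PointedVec : (X → Set) → ℕ → Set
    PointedVec P n = Σ (Vec X (suc n)) λ τ → Σ (Fin (suc n)) λ b → P (Vec.lookup τ b)

    pointedVec-↔ : (P : X → Set) {n : ℕ} → PointedVec P n ↔ (Fin (suc n) × Vec X n × Σ X P)
    pointedVec-↔ P = mk↔ₛ′ split insert split-insert insert-split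
      where
      split : ∀ {n} → PointedVec P n → Fin (suc n) × Vec X n × Σ X P
      split (τ , b , p) = b , removeAt τ b , Vec.lookup τ b , p

      cons : ∀ {n} → X → PointedVec P n → PointedVec P (suc n)
      cons y (τ , b , p) = y ∷ τ , suc b , p

      insert : ∀ {n} → Fin (suc n) × Vec X n × Σ X P → PointedVec P n
      insert (zero  , xs     , x , p) = x ∷ xs , zero , p
      insert (suc b , y ∷ ys , q)     = cons y (insert (b , ys , q))

      split-cons : ∀ {n} y (r : PointedVec P n) →
                   split (cons y r) ≡ (λ (b , ys , q) → suc b , y ∷ ys , q) (split r)
      split-cons y (_ ∷ _ , b , p) = refl

      split-insert : ∀ {n} (c : Fin (suc n) × Vec X n × Σ X P) → split (insert c) ≡ c
      split-insert (zero  , xs     , q) = refl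
      split-insert (suc b , y ∷ ys , q) =
        trans (split-cons y (insert (b , ys , q)))
              (cong (λ (b′ , ys′ , q′) → suc b′ , y ∷ ys′ , q′) (split-insert (b , ys , q)))

      insert-split : ∀ {n} (r : PointedVec P n) → insert (split r) ≡ r
      insert-split (x ∷ xs          , zero  , p) = refl
      insert-split (x ∷ xs@(_ ∷ _) , suc b , p) = cong (cons x) (insert-split (xs , b , p))

module Splitting where

  open import Data.Nat using (ℕ; zero; suc; _+_; _*_; _≤_; z≤n; s≤s)
  open import Data.Nat.Properties using (≤-irrelevant)
  open import Data.List using (List; []; _∷_; length; _++_)
  open import Data.Vec using (Vec; []; _∷_; splitAt; toList)
  import Data.Vec as Vec
  open import Data.Vec.Properties using (++-injective)
  open import Data.Product using (Σ; _×_; _,_; proj₁; proj₂)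
  open import Data.Product.Algebra using (×-cong)
  open import Function.Bundles using (_↔_; Inverse; mk↔ₛ′)
  open import Function.Properties.Inverse using (↔-refl; ↔-trans)
  open import Relation.Binary.PropositionalEquality
  open import Relation.Nullary using (¬_; contradiction)
  open Counting using (Vec-suc-↔; Σ-≡-irrelevant)

  open Inverse

  private variable
    X : Set
    m n : ℕ

  ++-↔ : (Vec X m × Vec X n) ↔ Vec X (m + n)
  ++-↔ {m = m} = mk↔ₛ′ (λ (xs , ys) → xs Vec.++ ys) split (λ zs → sym (proj₂ (proj₂ (splitAt m zs))))
    (λ (xs , ys) → let xs≡ , ys≡ = ++-injective xs _ (proj₂ (proj₂ (splitAt m (xs Vec.++ ys))))
                   in sym (cong₂ _,_ xs≡ ys≡))
    where
    split : Vec X (m + n) → Vec X m × Vec X n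
    split zs = proj₁ (splitAt m zs) , proj₁ (proj₂ (splitAt m zs))

  concat-↔ : ∀ n → Vec (Vec X m) n ↔ Vec X (n * m)
  concat-↔ zero    = mk↔ₛ′ (λ _ → []) (λ _ → []) (λ { [] → refl }) (λ { [] → refl })
  concat-↔ (suc n) = ↔-trans Vec-suc-↔ (↔-trans (×-cong ↔-refl (concat-↔ n)) ++-↔)

  AtLeast : ℕ → Set → Set
  AtLeast m X = Σ (List X) λ xs → m ≤ length xs

  length-toList-++ : (xs : Vec X m) (ys : List X) → length (toList xs ++ ys) ≡ m + length ys
  length-toList-++ []       ys = refl
  length-toList-++ (x ∷ xs) ys = cong suc (length-toList-++ xs ys)

  atLeast-↔ : AtLeast m X ↔ (Vec X m × List X)
  atLeast-↔ = mk↔ₛ′ (λ (xs , m≤) → split xs m≤) join split-join join-split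
    where
    split : ∀ {m} (xs : List X) → m ≤ length xs → Vec X m × List X
    split {m = zero}  xs       _         = [] , xs
    split {m = suc m} (x ∷ xs) (s≤s m≤) = let ys , zs = split xs m≤ in x ∷ ys , zs

    join-≤ : (ys : Vec X m) (zs : List X) → m ≤ length (toList ys ++ zs)
    join-≤ []       zs = z≤n
    join-≤ (y ∷ ys) zs = s≤s (join-≤ ys zs)

    join : Vec X m × List X → AtLeast m X
    join (ys , zs) = toList ys ++ zs , join-≤ ys zs

    split-join : ∀ {m} (c : Vec X m × List X) → split (proj₁ (join c)) (proj₂ (join c)) ≡ c
    split-join ([]     , zs) = refl
    split-join (y ∷ ys , zs) = cong (λ (ys′ , zs′) → y ∷ ys′ , zs′) (split-join (ys , zs))

    join-split : ∀ {m} (c : AtLeast m X) → join (split (proj₁ c) (proj₂ c)) ≡ c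
    join-split {m = zero}  (xs     , _)       = Σ-≡-irrelevant ≤-irrelevant refl
    join-split {m = suc m} (x ∷ xs , s≤s m≤) = Σ-≡-irrelevant ≤-irrelevant (cong (λ c → x ∷ proj₁ c) (join-split (xs , m≤)))

  Σ-nonempty-↔ : {Y : Set} {P : List X × Y → Set} → (∀ y → ¬ P ([] , y)) →
                 Σ (List X × Y) P ↔ Σ (X × List X × Y) (λ (x , xs , y) → P (x ∷ xs , y))
  Σ-nonempty-↔ {X = X} {Y = Y} {P} ¬P[] = mk↔ₛ′ to′ from′ (λ _ → refl) from-to
    where
    to′ : Σ (List X × Y) P → Σ (X × List X × Y) (λ (x , xs , y) → P (x ∷ xs , y))
    to′ (([]     , y) , p) = contradiction p (¬P[] y)
    to′ ((x ∷ xs , y) , p) = (x , xs , y) , p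

    from′ : Σ (X × List X × Y) (λ (x , xs , y) → P (x ∷ xs , y)) → Σ (List X × Y) P
    from′ ((x , xs , y) , p) = (x ∷ xs , y) , p

    from-to : ∀ z → from′ (to′ z) ≡ z
    from-to (([]     , y) , p) = contradiction p (¬P[] y)
    from-to ((x ∷ xs , y) , p) = refl

module Zipper (d′ : ℕ) where

  open import Data.Nat using (ℕ; zero; suc; _+_; _*_; _∸_; _≤_)
  open import Data.Nat.Properties using (+-assoc; +-suc; m+n∸m≡n; m+[n∸m]≡n)
  open import Data.Nat.ListAction using (sum)
  open import Data.Fin using (Fin; zero; suc; toℕ)
  open import Data.Fin.Properties using (toℕ≤pred[n])
  open import Data.List using (List; []; _∷_; length; _++_; map)
  import Data.List as List
  open import Data.List.Properties using (length-++; ++-identityʳ)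
  open import Data.Vec using (Vec; _∷_; removeAt)
  import Data.Vec as Vec
  open import Data.Product using (Σ; _×_; _,_; proj₁; proj₂)
  open import Data.Product.Algebra using (×-cong)
  open import Function.Bundles using (_↔_; Inverse; mk↔ₛ′)
  open import Function.Properties.Inverse using (↔-refl; ↔-trans)
  open import Relation.Binary.PropositionalEquality
  open import Data.Nat.Tactic.RingSolver using (solve-∀)
  open import Defs
  open Pointed

  open Inverse

  d : ℕ
  d = suc d′

  Tuplet : Set
  Tuplet = Vec (Tree d) d

  -- A hole at a child position: the tuplets before and after the hole's tuplet, the position of
  -- the hole inside its tuplet, and the other d − 1 members of that tuplet.
  Frame : Set
  Frame = List Tuplet × List Tuplet × Fin d × Vec (Tree d) d′

  PointedTree : Set
  PointedTree = Σ (Tree d) Vertex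

  frameAt : (ts : List Tuplet) → Fin (length ts) → Fin d → Frame
  frameAt ts a b = prefix ts a , suffix ts a , b , removeAt (List.lookup ts a) b

  BelowRoot : Set
  BelowRoot = PointedList λ (τ : Tuplet) → Σ (Fin d) λ b → Vertex (Vec.lookup τ b)

  belowRoot-↔ : BelowRoot ↔ (Frame × PointedTree)
  belowRoot-↔ = ↔-trans (pointedList-↔ _) (↔-trans (×-cong ↔-refl (×-cong ↔-refl (pointedVec-↔ Vertex))) reassoc)
    where
    reassoc : (List Tuplet × List Tuplet × Fin d × Vec (Tree d) d′ × PointedTree) ↔ (Frame × PointedTree)
    reassoc = mk↔ₛ′ (λ (bef , aft , b , rest , x) → (bef , aft , b , rest) , x)
                    (λ ((bef , aft , b , rest) , x) → bef , aft , b , rest , x)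
                    (λ _ → refl) (λ _ → refl)

  belowRoot : BelowRoot → PointedTree
  belowRoot (ts , a , b , v) = node ts , below a b v

  plug : Frame → PointedTree → PointedTree
  plug f x = belowRoot (from belowRoot-↔ (f , x))

  plug-stat : {A : Set} (S : PointedTree → A) (G : Frame → PointedTree → A) →
              (∀ ts a b (v : Vertex (Vec.lookup (List.lookup ts a) b)) → S (node ts , below a b v) ≡ G (frameAt ts a b) (_ , v)) →
              ∀ f x → S (plug f x) ≡ G f x
  plug-stat S G S≡G f x with from belowRoot-↔ (f , x) | strictlyInverseˡ belowRoot-↔ (f , x)
  ... | ts , a , b , v | eq = trans (S≡G ts a b v) (cong (λ (f′ , x′) → G f′ x′) eq)

  plug-frameAt : ∀ ts a b (v : Vertex (Vec.lookup (List.lookup ts a) b)) → plug (frameAt ts a b) (_ , v) ≡ (node ts , below a b v)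
  plug-frameAt ts a b v = cong belowRoot (strictlyInverseʳ belowRoot-↔ (ts , a , b , v))

  -- Frames are listed from the marked vertex up to the root.
  unzip : List Frame → (t : Tree d) → Vertex t → List Frame × Tree d
  unzip fs t         root          = fs , t
  unzip fs (node ts) (below a b v) = unzip (frameAt ts a b ∷ fs) _ v

  zipUp : List Frame → PointedTree → PointedTree
  zipUp []       x = x
  zipUp (f ∷ fs) x = zipUp fs (plug f x)

  unzip-plug : ∀ fs f x → unzip fs _ (proj₂ (plug f x)) ≡ unzip (f ∷ fs) _ (proj₂ x)
  unzip-plug fs = plug-stat (λ (t , v) → unzip fs t v) (λ f (t , v) → unzip (f ∷ fs) t v) λ _ _ _ _ → refl

  unzip-zipUp : ∀ fs acc x → unzip acc _ (proj₂ (zipUp fs x)) ≡ unzip (fs ++ acc) _ (proj₂ x)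
  unzip-zipUp []       acc x = refl
  unzip-zipUp (f ∷ fs) acc x = trans (unzip-zipUp fs acc (plug f x)) (unzip-plug (fs ++ acc) f x)

  zipUp-unzip : ∀ acc t v → zipUp (proj₁ (unzip acc t v)) (proj₂ (unzip acc t v) , root) ≡ zipUp acc (t , v)
  zipUp-unzip acc t         root          = refl
  zipUp-unzip acc (node ts) (below a b v) =
    trans (zipUp-unzip (frameAt ts a b ∷ acc) _ v) (cong (zipUp acc) (plug-frameAt ts a b v))

  zipper-↔ : PointedTree ↔ (List Frame × Tree d)
  zipper-↔ = mk↔ₛ′ (λ (t , v) → unzip [] t v) (λ (fs , t) → zipUp fs (t , root))
    (λ (fs , t) → trans (unzip-zipUp fs [] (t , root)) (cong (_, t) (++-identityʳ fs)))
    (λ (t , v) → zipUp-unzip [] t v)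

  frameSize : Frame → ℕ
  frameSize (bef , aft , _ , rest) = suc (tuplets (node bef) + (tuplets (node aft) + tupletsV rest))

  framesSize : List Frame → ℕ
  framesSize fs = sum (map frameSize fs)

  tupletsL-++ : (xs ys : List Tuplet) → tupletsL (xs ++ ys) ≡ tupletsL xs + tupletsL ys
  tupletsL-++ []       ys = refl
  tupletsL-++ (x ∷ xs) ys = trans (cong (tupletsV x +_) (tupletsL-++ xs ys)) (sym (+-assoc (tupletsV x) _ _))

  tupletsV-removeAt : ∀ {n} (τ : Vec (Tree d) (suc n)) b →
                      tupletsV τ ≡ tuplets (Vec.lookup τ b) + tupletsV (removeAt τ b)
  tupletsV-removeAt (t ∷ ts)         zero    = refl
  tupletsV-removeAt (t ∷ ts@(_ ∷ _)) (suc b) =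
    trans (cong (tuplets t +_) (tupletsV-removeAt ts b)) (swap (tuplets t) (tuplets (Vec.lookup ts b)) (tupletsV (removeAt ts b)))
    where
    swap : ∀ x y z → x + (y + z) ≡ y + (x + z)
    swap = solve-∀

  tuplets-frameAt : ∀ ts a b → tuplets (node ts) ≡ frameSize (frameAt ts a b) + tuplets (Vec.lookup (List.lookup ts a) b)
  tuplets-frameAt ts a b = begin
    length ts + tupletsL ts
      ≡⟨ cong (λ ts′ → length ts′ + tupletsL ts′) (sym (prefix-lookup-suffix ts a)) ⟩
    length (pre ++ τ ∷ suf) + tupletsL (pre ++ τ ∷ suf)
      ≡⟨ cong₂ _+_ (length-++ pre) (tupletsL-++ pre (τ ∷ suf)) ⟩
    length pre + suc (length suf) + (tupletsL pre + (tupletsV τ + tupletsL suf))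
      ≡⟨ cong (λ n → length pre + suc (length suf) + (tupletsL pre + (n + tupletsL suf))) (tupletsV-removeAt τ b) ⟩
    length pre + suc (length suf) + (tupletsL pre + ((t + tupletsV rest) + tupletsL suf))
      ≡⟨ rearrange (length pre) (length suf) (tupletsL pre) (tupletsL suf) t (tupletsV rest) ⟩
    frameSize (frameAt ts a b) + t ∎
    where
    open ≡-Reasoning
    pre = prefix ts a
    suf = suffix ts a
    τ = List.lookup ts a
    t = tuplets (Vec.lookup τ b)
    rest = removeAt τ b
    rearrange : ∀ lp ls tp ts t r → lp + suc ls + (tp + ((t + r) + ts)) ≡ suc ((lp + tp) + ((ls + ts) + r)) + t
    rearrange = solve-∀

  tuplets-plug : ∀ f x → tuplets (proj₁ (plug f x)) ≡ frameSize f + tuplets (proj₁ x)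
  tuplets-plug = plug-stat (λ x → tuplets (proj₁ x)) (λ f x → frameSize f + tuplets (proj₁ x)) λ ts a b _ → tuplets-frameAt ts a b

  tuplets-zipUp : ∀ fs x → tuplets (proj₁ (zipUp fs x)) ≡ framesSize fs + tuplets (proj₁ x)
  tuplets-zipUp []       x = refl
  tuplets-zipUp (f ∷ fs) x = begin
    tuplets (proj₁ (zipUp fs (plug f x)))          ≡⟨ tuplets-zipUp fs (plug f x) ⟩
    framesSize fs + tuplets (proj₁ (plug f x))     ≡⟨ cong (framesSize fs +_) (tuplets-plug f x) ⟩
    framesSize fs + (frameSize f + tuplets (proj₁ x)) ≡⟨ swap (framesSize fs) (frameSize f) _ ⟩
    frameSize f + framesSize fs + tuplets (proj₁ x) ∎
    where
    open ≡-Reasoning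
    swap : ∀ x y z → x + (y + z) ≡ y + x + z
    swap = solve-∀

  level-zipUp : ∀ fs x → level (proj₂ (zipUp fs x)) ≡ length fs + level (proj₂ x)
  level-zipUp []       x = refl
  level-zipUp (f ∷ fs) x =
    trans (level-zipUp fs (plug f x))
          (trans (cong (length fs +_) (plug-stat (λ x → level (proj₂ x)) (λ _ x → suc (level (proj₂ x))) (λ _ _ _ _ → refl) f x))
                 (+-suc (length fs) _))

  children-below : ∀ {ts : List Tuplet} a b (v : Vertex (Vec.lookup (List.lookup ts a) b)) → children (below {ts = ts} a b v) ≡ children v
  children-below a b v with subtree v
  ... | node _ = refl

  children-zipUp : ∀ fs x → children (proj₂ (zipUp fs x)) ≡ children (proj₂ x)
  children-zipUp []       x = refl
  children-zipUp (f ∷ fs) x =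
    trans (children-zipUp fs (plug f x))
          (plug-stat (λ x → children (proj₂ x)) (λ _ x → children (proj₂ x)) (λ ts a b v → children-below {ts} a b v) f x)

  frameElders : Frame → ℕ
  frameElders (bef , _ , b , _) = length bef * d + toℕ b

  frameYoungers : Frame → ℕ
  frameYoungers (_ , aft , b , _) = length aft * d + (d′ ∸ toℕ b)

  elderAux-plug : ∀ c f x → elderAux c (proj₂ (plug f x)) ≡ elderAux (frameElders f) (proj₂ x)
  elderAux-plug c = plug-stat (λ x → elderAux c (proj₂ x)) (λ f x → elderAux (frameElders f) (proj₂ x))
    λ ts a b v → cong (λ l → elderAux (l * d + toℕ b) v) (sym (length-prefix ts a))

  siblings-after : ∀ p s b → b ≤ d′ → (p + suc s) * d ∸ suc (p * d + b) ≡ s * d + (d′ ∸ b)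
  siblings-after p s b b≤d′ = begin
    (p + suc s) * d ∸ suc (p * d + b)                      ≡⟨ cong (λ e → (p + suc s) * suc e ∸ suc (p * suc e + b)) (sym (m+[n∸m]≡n b≤d′)) ⟩
    (p + suc s) * suc (b + r) ∸ suc (p * suc (b + r) + b)   ≡⟨ cong (_∸ suc (p * suc (b + r) + b)) (expand p s b r) ⟩
    suc (p * suc (b + r) + b) + (s * suc (b + r) + r) ∸ suc (p * suc (b + r) + b) ≡⟨ m+n∸m≡n (suc (p * suc (b + r) + b)) _ ⟩
    s * suc (b + r) + r                                      ≡⟨ cong (λ e → s * suc e + r) (m+[n∸m]≡n b≤d′) ⟩
    s * d + (d′ ∸ b) ∎
    where
    open ≡-Reasoning
    r = d′ ∸ b
    expand : ∀ p s b r → (p + suc s) * suc (b + r) ≡ suc (p * suc (b + r) + b) + (s * suc (b + r) + r)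
    expand = solve-∀

  youngerAux-plug : ∀ c f x → youngerAux c (proj₂ (plug f x)) ≡ youngerAux (frameYoungers f) (proj₂ x)
  youngerAux-plug c = plug-stat (λ x → youngerAux c (proj₂ x)) (λ f x → youngerAux (frameYoungers f) (proj₂ x))
    λ ts a b v → cong (λ y → youngerAux y v) (youngers ts a b)
    where
    youngers : ∀ ts a b → length ts * d ∸ suc (toℕ a * d + toℕ b) ≡ length (suffix ts a) * d + (d′ ∸ toℕ b)
    youngers ts a b = begin
      length ts * d ∸ suc (toℕ a * d + toℕ b)
        ≡⟨ cong₂ (λ l p → l * d ∸ suc (p * d + toℕ b))
                 (trans (cong length (sym (prefix-lookup-suffix ts a))) (length-++ (prefix ts a)))
                 (sym (length-prefix ts a)) ⟩
      (length (prefix ts a) + suc (length (suffix ts a))) * d ∸ suc (length (prefix ts a) * d + toℕ b)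
        ≡⟨ siblings-after (length (prefix ts a)) (length (suffix ts a)) (toℕ b) (toℕ≤pred[n] b) ⟩
      length (suffix ts a) * d + (d′ ∸ toℕ b) ∎
      where open ≡-Reasoning

  elderAux-zipUp : ∀ c f fs x → elderAux c (proj₂ (zipUp (f ∷ fs) x)) ≡ elderAux (frameElders f) (proj₂ x)
  elderAux-zipUp c f []       x = elderAux-plug c f x
  elderAux-zipUp c f (g ∷ fs) x = trans (elderAux-zipUp c g fs (plug f x)) (elderAux-plug (frameElders g) f x)

  youngerAux-zipUp : ∀ c f fs x → youngerAux c (proj₂ (zipUp (f ∷ fs) x)) ≡ youngerAux (frameYoungers f) (proj₂ x)
  youngerAux-zipUp c f []       x = youngerAux-plug c f x
  youngerAux-zipUp c f (g ∷ fs) x = trans (youngerAux-zipUp c g fs (plug f x)) (youngerAux-plug (frameYoungers g) f x)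

module Binomial where

  open import Data.Nat using (zero; suc; _+_; _*_)
  open import Data.Nat.Properties using (*-zeroʳ; *-identityˡ; *-identityʳ; *-distribˡ-+; *-cancelˡ-≡; +-cancelˡ-≡)
  open import Data.Nat.Combinatorics using (_C_; nCk+nC[k+1]≡[n+1]C[k+1]; nC1≡n)
  open import Relation.Binary.PropositionalEquality
  open import Data.Nat.Tactic.RingSolver using (solve-∀)

  C-absorption : ∀ n k → suc k * (suc n C suc k) ≡ suc n * (n C k)
  C-absorption zero    zero    = refl
  C-absorption zero    (suc k) = *-zeroʳ (suc (suc k))
  C-absorption (suc n) zero    = trans (*-identityˡ _) (trans (nC1≡n (suc (suc n))) (sym (*-identityʳ (suc (suc n)))))
  C-absorption (suc n) (suc k) = begin
    suc (suc k) * (suc (suc n) C suc (suc k))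
      ≡⟨ cong (suc (suc k) *_) (sym (nCk+nC[k+1]≡[n+1]C[k+1] (suc n) (suc k))) ⟩
    suc (suc k) * (suc n C suc k + suc n C suc (suc k))
      ≡⟨ *-distribˡ-+ (suc (suc k)) (suc n C suc k) _ ⟩
    suc (suc k) * (suc n C suc k) + suc (suc k) * (suc n C suc (suc k))
      ≡⟨ cong₂ (λ x y → suc n C suc k + x + y) (C-absorption n k) (C-absorption n (suc k)) ⟩
    suc n C suc k + suc n * (n C k) + suc n * (n C suc k)
      ≡⟨ regroup (suc n C suc k) (suc n) (n C k) (n C suc k) ⟩
    suc n C suc k + suc n * (n C k + n C suc k)
      ≡⟨ cong (λ x → suc n C suc k + suc n * x) (nCk+nC[k+1]≡[n+1]C[k+1] n k) ⟩
    suc (suc n) * (suc n C suc k) ∎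
    where
    open ≡-Reasoning
    regroup : ∀ a n b c → a + n * b + n * c ≡ a + n * (b + c)
    regroup = solve-∀

  C-ratio : ∀ d m → (suc d * m + d) C suc m ≡ d * ((suc d * m + d) C m)
  C-ratio d m = *-cancelˡ-≡ _ _ (suc m) (+-cancelˡ-≡ (suc m * B) _ _ (begin
    suc m * B + suc m * B′       ≡⟨ sym (*-distribˡ-+ (suc m) B B′) ⟩
    suc m * (B + B′)             ≡⟨ cong (suc m *_) (nCk+nC[k+1]≡[n+1]C[k+1] Q m) ⟩
    suc m * (suc Q C suc m)      ≡⟨ C-absorption Q m ⟩
    suc Q * B                    ≡⟨ expand d m B ⟩
    suc m * B + suc m * (d * B) ∎))
    where
    open ≡-Reasoning
    Q = suc d * m + d
    B = Q C m
    B′ = Q C suc m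
    expand : ∀ d m b → suc (suc d * m + d) * b ≡ suc m * b + suc m * (d * b)
    expand = solve-∀

module Forests (d′ : ℕ) where

  open import Data.Nat using (zero; suc; _+_; _*_; _∸_)
  open import Data.Nat.Properties using (+-assoc; +-comm; +-suc; +-identityʳ; *-zeroʳ; 0∸n≡0)
  open import Data.Nat.Combinatorics using (_C_; nCk+nC[k+1]≡[n+1]C[k+1])
  open import Data.Fin using (Fin; zero)
  open import Data.List using (List; []; _∷_; length; _++_)
  open import Data.Vec using (Vec; []; _∷_; toList)
  import Data.Vec as Vec
  open import Data.Product using (_×_; _,_; proj₁; proj₂)
  open import Data.Product.Algebra using (Σ-assoc; ×-cong)
  open import Data.Sum using (_⊎_; inj₁; inj₂; [_,_]′)
  open import Data.Unit using (⊤; tt)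
  open import Function.Bundles using (_↔_; Inverse; mk↔ₛ′)
  open import Function.Properties.Inverse using (↔-refl; ↔-sym; ↔-trans)
  open import Relation.Binary.PropositionalEquality
  open import Data.Nat.Tactic.RingSolver using (solve-∀)
  open import Defs
  open Counting
  open Splitting using (++-↔; concat-↔; AtLeast; atLeast-↔; length-toList-++)
  open Binomial using (C-ratio)
  open Zipper d′ using (d; Tuplet; Frame; framesSize; tupletsL-++)

  open Inverse

  tupletsV-++ : ∀ {m n} (xs : Vec (Tree d) m) (ys : Vec (Tree d) n) →
                tupletsV (xs Vec.++ ys) ≡ tupletsV xs + tupletsV ys
  tupletsV-++ []       ys = refl
  tupletsV-++ (x ∷ xs) ys = trans (cong (tuplets x +_) (tupletsV-++ xs ys)) (sym (+-assoc (tuplets x) _ _))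

  frame-↔ : Frame ↔ (Fin d × Vec (Tree d) (suc d))
  frame-↔ = mk↔ₛ′ to′ from′ (λ { (b , node _ ∷ node _ ∷ _) → refl }) (λ _ → refl)
    where
    to′ : Frame → Fin d × Vec (Tree d) (suc d)
    to′ (bef , aft , b , rest) = b , node bef ∷ node aft ∷ rest

    from′ : Fin d × Vec (Tree d) (suc d) → Frame
    from′ (b , node bef ∷ node aft ∷ rest) = bef , aft , b , rest

  FramedForest : ℕ → Set
  FramedForest r = Vec (Tree d) r × List Frame

  framedSize : ∀ {r} → FramedForest r → ℕ
  framedSize (ts , fs) = tupletsV ts + framesSize fs

  peel-zero : FramedForest 0 ↔ (⊤ ⊎ Fin d × FramedForest (suc d))
  peel-zero = mk↔ₛ′ to′ from′ (λ { (inj₁ tt) → refl ; (inj₂ (b , node _ ∷ node _ ∷ _ , fs)) → refl })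
                              (λ { ([] , []) → refl ; ([] , _ ∷ _) → refl })
    where
    to′ : FramedForest 0 → ⊤ ⊎ Fin d × FramedForest (suc d)
    to′ ([] , [])     = inj₁ tt
    to′ ([] , f ∷ fs) = let b , ts = to frame-↔ f in inj₂ (b , ts , fs)

    from′ : ⊤ ⊎ Fin d × FramedForest (suc d) → FramedForest 0
    from′ (inj₁ tt)           = [] , []
    from′ (inj₂ (b , ts , fs)) = [] , from frame-↔ (b , ts) ∷ fs

  peel-zero-size : (o : FramedForest 0) →
                   framedSize o ≡ [ (λ _ → 0) , (λ (_ , o′) → suc (framedSize o′)) ]′ (to peel-zero o)
  peel-zero-size ([] , [])    = refl
  peel-zero-size ([] , _ ∷ _) = refl

  peel-suc : ∀ {r} → FramedForest (suc r) ↔ (FramedForest r ⊎ FramedForest (d + suc r))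
  peel-suc {r} = mk↔ₛ′ to′ from′ to-from from-to
    where
    split-↔ : (Tuplet × Vec (Tree d) (suc r)) ↔ Vec (Tree d) (d + suc r)
    split-↔ = ++-↔

    to′ : FramedForest (suc r) → FramedForest r ⊎ FramedForest (d + suc r)
    to′ (node []       ∷ ts , fs) = inj₁ (ts , fs)
    to′ (node (τ ∷ us) ∷ ts , fs) = inj₂ (τ Vec.++ node us ∷ ts , fs)

    unpeel : Tuplet × Vec (Tree d) (suc r) → Vec (Tree d) (suc r)
    unpeel (τ , node us ∷ ts) = node (τ ∷ us) ∷ ts

    from′ : FramedForest r ⊎ FramedForest (d + suc r) → FramedForest (suc r)
    from′ (inj₁ (ts , fs)) = node [] ∷ ts , fs
    from′ (inj₂ (ws , fs)) = unpeel (from split-↔ ws) , fs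

    to-unpeel : ∀ p fs → to′ (unpeel p , fs) ≡ inj₂ (to split-↔ p , fs)
    to-unpeel (τ , node us ∷ ts) fs = refl

    to-from : ∀ y → to′ (from′ y) ≡ y
    to-from (inj₁ _) = refl
    to-from (inj₂ (ws , fs)) =
      trans (to-unpeel (from split-↔ ws) fs) (cong (λ ws′ → inj₂ (ws′ , fs)) (strictlyInverseˡ split-↔ ws))

    from-to : ∀ x → from′ (to′ x) ≡ x
    from-to (node []       ∷ ts , fs) = refl
    from-to (node (τ ∷ us) ∷ ts , fs) = cong (λ p → unpeel p , fs) (strictlyInverseʳ split-↔ (τ , node us ∷ ts))

  peel-suc-size : ∀ {r} (o : FramedForest (suc r)) →
                  framedSize o ≡ [ framedSize , (λ o′ → suc (framedSize o′)) ]′ (to peel-suc o)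
  peel-suc-size (node []       ∷ ts , fs) = refl
  peel-suc-size (node (τ ∷ us) ∷ ts , fs) = begin
    suc (length us + (tupletsV τ + tupletsL us)) + tupletsV ts + framesSize fs
      ≡⟨ regroup (length us) (tupletsV τ) (tupletsL us) (tupletsV ts) (framesSize fs) ⟩
    suc (tupletsV τ + tupletsV (node us ∷ ts) + framesSize fs)
      ≡⟨ cong (λ n → suc (n + framesSize fs)) (sym (tupletsV-++ τ (node us ∷ ts))) ⟩
    suc (tupletsV (τ Vec.++ node us ∷ ts) + framesSize fs) ∎
    where
    open ≡-Reasoning
    regroup : ∀ l t u v f → suc (l + (t + u)) + v + f ≡ suc (t + ((l + u) + v) + f)
    regroup = solve-∀

  -- 1 ∸ m counts the empty framed forest, which has size 0.
  framedCount  : ℕ → ℕ → ℕ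
  framedCount′ : ℕ → ℕ → ℕ
  framedCount zero    m = (1 ∸ m) + d * framedCount′ (suc d) m
  framedCount (suc r) m = framedCount r m + framedCount′ (d + suc r) m
  framedCount′ r zero    = 0
  framedCount′ r (suc m) = framedCount r m

  framedForest-count  : ∀ r m → Fibre (framedSize {r}) m ↔ Fin (framedCount r m)
  framedForest-count′ : ∀ r m → Fibre (λ (o : FramedForest r) → suc (framedSize o)) m ↔ Fin (framedCount′ r m)
  framedForest-count zero m =
    ↔-trans (fibre-↔ peel-zero peel-zero-size)
    (↔-trans fibre-⊎ (⊎-count (empty-fibre m) (↔-trans Σ-assoc (×-count ↔-refl (framedForest-count′ (suc d) m)))))
    where
    empty-fibre : ∀ m → Fibre (λ (_ : ⊤) → 0) m ↔ Fin (1 ∸ m)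
    empty-fibre zero    = mk↔ₛ′ (λ _ → zero) (λ _ → tt , refl) (λ { zero → refl }) (λ { (tt , refl) → refl })
    empty-fibre (suc zero)    = empty-↔ λ ()
    empty-fibre (suc (suc m)) = empty-↔ λ ()
  framedForest-count (suc r) m =
    ↔-trans (fibre-↔ peel-suc peel-suc-size)
    (↔-trans fibre-⊎ (⊎-count (framedForest-count r m) (framedForest-count′ (d + suc r) m)))
  framedForest-count′ r zero    = empty-↔ λ ()
  framedForest-count′ r (suc m) = ↔-trans fibre-suc (framedForest-count r m)

  framedCount-closed : ∀ r m → framedCount r m ≡ (suc d * m + r ∸ 1) C m
  framedCount-closed zero    zero    = cong suc (*-zeroʳ d′)
  framedCount-closed zero    (suc m) = begin
    (0 ∸ m) + d * framedCount (suc d) m   ≡⟨ cong (_+ d * framedCount (suc d) m) (0∸n≡0 m) ⟩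
    d * framedCount (suc d) m             ≡⟨ cong (d *_) (framedCount-closed (suc d) m) ⟩
    d * ((suc d * m + suc d ∸ 1) C m)     ≡⟨ cong (λ n → d * ((n ∸ 1) C m)) (+-suc (suc d * m) d) ⟩
    d * ((suc d * m + d) C m)             ≡⟨ sym (C-ratio d m) ⟩
    (suc d * m + d) C suc m               ≡⟨ cong (_C suc m) (cong (_∸ 1) (expand d m)) ⟩
    (suc d * suc m + 0 ∸ 1) C suc m ∎
    where
    open ≡-Reasoning
    expand : ∀ d m → suc (suc d * m + d) ≡ suc d * suc m + 0
    expand = solve-∀
  framedCount-closed (suc r) zero    = trans (+-identityʳ (framedCount r 0)) (framedCount-closed r zero)
  framedCount-closed (suc r) (suc m) = begin
    framedCount r (suc m) + framedCount (d + suc r) m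
      ≡⟨ cong₂ _+_ (framedCount-closed r (suc m)) (framedCount-closed (d + suc r) m) ⟩
    (suc d * suc m + r ∸ 1) C suc m + (suc d * m + (d + suc r) ∸ 1) C m
      ≡⟨ cong₂ (λ x y → x C suc m + y C m) (cong (_∸ 1) (expand₁ d m r)) (cong (_∸ 1) (expand₂ d m r)) ⟩
    Q C suc m + Q C m
      ≡⟨ trans (+-comm (Q C suc m) (Q C m)) (nCk+nC[k+1]≡[n+1]C[k+1] Q m) ⟩
    suc Q C suc m
      ≡⟨ cong (_C suc m) (cong (_∸ 1) (sym (expand₃ d m r))) ⟩
    (suc d * suc m + suc r ∸ 1) C suc m ∎
    where
    open ≡-Reasoning
    Q = suc d * m + d + r
    expand₁ : ∀ d m r → suc d * suc m + r ≡ suc (suc d * m + d + r)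
    expand₁ = solve-∀
    expand₂ : ∀ d m r → suc d * m + (d + suc r) ≡ suc (suc d * m + d + r)
    expand₂ = solve-∀
    expand₃ : ∀ d m r → suc d * suc m + suc r ≡ suc (suc (suc d * m + d + r))
    expand₃ = solve-∀

  node-↔ : List Tuplet ↔ Tree d
  node-↔ = mk↔ₛ′ node (λ { (node ts) → ts }) (λ { (node _) → refl }) (λ _ → refl)

  tupletsL-toList : ∀ {m} (ys : Vec Tuplet m) → tupletsL (toList ys) ≡ tupletsV (to (concat-↔ m) ys)
  tupletsL-toList []       = refl
  tupletsL-toList (y ∷ ys) = trans (cong (tupletsV y +_) (tupletsL-toList ys)) (sym (tupletsV-++ y _))

  atLeast-tuplets-↔ : ∀ m → AtLeast m Tuplet ↔ (Vec (Tree d) (m * d) × Tree d)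
  atLeast-tuplets-↔ m = ↔-trans atLeast-↔ (×-cong (concat-↔ m) node-↔)

  atLeast-tuplets-size : ∀ m (x : AtLeast m Tuplet) →
    tuplets (node (proj₁ x)) ≡ m + (tupletsV (proj₁ (to (atLeast-tuplets-↔ m) x)) + tuplets (proj₂ (to (atLeast-tuplets-↔ m) x)))
  atLeast-tuplets-size m = size-law-from atLeast-↔ law
    where
    law : ∀ ((ys , zs) : Vec Tuplet m × List Tuplet) →
          tuplets (node (toList ys ++ zs)) ≡ m + (tupletsV (to (concat-↔ m) ys) + tuplets (node zs))
    law (ys , zs) = begin
      length (toList ys ++ zs) + tupletsL (toList ys ++ zs)
        ≡⟨ cong₂ _+_ (length-toList-++ ys zs) (tupletsL-++ (toList ys) zs) ⟩
      m + length zs + (tupletsL (toList ys) + tupletsL zs)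
        ≡⟨ cong (λ t → m + length zs + (t + tupletsL zs)) (tupletsL-toList ys) ⟩
      m + length zs + (tupletsV (to (concat-↔ m) ys) + tupletsL zs)
        ≡⟨ regroup m (length zs) _ (tupletsL zs) ⟩
      m + (tupletsV (to (concat-↔ m) ys) + (length zs + tupletsL zs)) ∎
      where
      open ≡-Reasoning
      regroup : ∀ m l t u → m + l + (t + u) ≡ m + (t + (l + u))
      regroup = solve-∀

  framesVec-↔ : ∀ ℓ → Vec Frame ℓ ↔ (Vec (Fin d) ℓ × Vec (Tree d) (ℓ * suc d))
  framesVec-↔ zero    = mk↔ₛ′ (λ _ → [] , []) (λ _ → []) (λ { ([] , []) → refl }) (λ { [] → refl })
  framesVec-↔ (suc ℓ) =
    ↔-trans Vec-suc-↔ (↔-trans (×-cong frame-↔ (framesVec-↔ ℓ)) (↔-trans interchange (×-cong (↔-sym Vec-suc-↔) ++-↔)))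
    where
    interchange : ∀ {A B C D : Set} → ((A × B) × (C × D)) ↔ ((A × C) × (B × D))
    interchange = mk↔ₛ′ (λ ((a , b) , (c , e)) → (a , c) , (b , e)) (λ ((a , c) , (b , e)) → (a , b) , (c , e)) (λ _ → refl) (λ _ → refl)

  atLeast-frames-↔ : ∀ ℓ → AtLeast ℓ Frame ↔ ((Vec (Fin d) ℓ × Vec (Tree d) (ℓ * suc d)) × List Frame)
  atLeast-frames-↔ ℓ = ↔-trans atLeast-↔ (×-cong (framesVec-↔ ℓ) ↔-refl)

  atLeast-frames-size : ∀ ℓ (x : AtLeast ℓ Frame) →
    framesSize (proj₁ x) ≡ ℓ + (tupletsV (proj₂ (proj₁ (to (atLeast-frames-↔ ℓ) x))) + framesSize (proj₂ (to (atLeast-frames-↔ ℓ) x)))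
  atLeast-frames-size ℓ = size-law-from atLeast-↔ (λ (fs , zs) → law fs zs)
    where
    law : ∀ {ℓ} (fs : Vec Frame ℓ) zs → framesSize (toList fs ++ zs) ≡ ℓ + (tupletsV (proj₂ (to (framesVec-↔ ℓ) fs)) + framesSize zs)
    law []       zs = refl
    law {suc ℓ} ((bef , aft , b , rest) ∷ fs) zs = begin
      suc (t + framesSize (toList fs ++ zs))                   ≡⟨ cong (λ s → suc (t + s)) (law fs zs) ⟩
      suc (t + (ℓ + (tupletsV ts + framesSize zs)))           ≡⟨ cong suc (regroup t ℓ (tupletsV ts) (framesSize zs)) ⟩
      suc (ℓ + ((t + tupletsV ts) + framesSize zs))
        ≡⟨ cong (λ s → suc (ℓ + (s + framesSize zs))) (tupletsV-++ (node bef ∷ node aft ∷ rest) ts) ⟨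
      suc (ℓ + (tupletsV ((node bef ∷ node aft ∷ rest) Vec.++ ts) + framesSize zs)) ∎
      where
      open ≡-Reasoning
      t = tuplets (node bef) + (tuplets (node aft) + tupletsV rest)
      ts = proj₂ (to (framesVec-↔ ℓ) fs)
      regroup : ∀ t ℓ u z → t + (ℓ + (u + z)) ≡ ℓ + ((t + u) + z)
      regroup = solve-∀

module Digits where

  open import Data.Nat
  open import Data.Nat.Properties
  open import Data.Nat.DivMod using (_%_; [m+kn]%n≡m%n; m<n⇒m%n≡m)
  open import Data.Product using (_×_; _,_)
  open import Function.Bundles using (_⇔_; mk⇔)
  open import Relation.Nullary using (yes; no; contradiction)
  open import Relation.Binary.PropositionalEquality
  open import Data.Nat.Tactic.RingSolver using (solve-∀)
  open Counting using (sumBelow)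

  ⟦_<_⟧ : ℕ → ℕ → ℕ
  ⟦ c < r ⟧ with c <? r
  ... | yes _ = 1
  ... | no  _ = 0

  ⟦<⟧≡1 : ∀ {c r} → c < r → ⟦ c < r ⟧ ≡ 1
  ⟦<⟧≡1 {c} {r} c<r with c <? r
  ... | yes _   = refl
  ... | no  c≮r = contradiction c<r c≮r

  ⟦<⟧≡0 : ∀ {c r} → r ≤ c → ⟦ c < r ⟧ ≡ 0
  ⟦<⟧≡0 {c} {r} r≤c with c <? r
  ... | yes c<r = contradiction r≤c (<⇒≱ c<r)
  ... | no  _   = refl

  digits-≤ : ∀ {d r c} q L → r < d → c < d → (r + q * d ≤ L * d + c) ⇔ (q + ⟦ c < r ⟧ ≤ L)
  digits-≤ {d} {r} {c} q L r<d c<d with c <? r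
  ... | yes c<r = mk⇔
    (λ le → subst (_≤ L) (+-comm 1 q) (≰⇒> λ L≤q → <⇒≱ (too-big L≤q) le))
    (λ q+1≤L → begin
       r + q * d    ≤⟨ +-monoˡ-≤ (q * d) (<⇒≤ r<d) ⟩
       suc q * d    ≤⟨ *-monoˡ-≤ d (subst (_≤ L) (+-comm q 1) q+1≤L) ⟩
       L * d        ≤⟨ m≤m+n (L * d) c ⟩
       L * d + c    ∎)
    where
    open ≤-Reasoning
    too-big : L ≤ q → L * d + c < r + q * d
    too-big L≤q = begin-strict
      L * d + c    ≤⟨ +-monoˡ-≤ c (*-monoˡ-≤ d L≤q) ⟩
      q * d + c    <⟨ +-monoʳ-< (q * d) c<r ⟩
      q * d + r    ≡⟨ +-comm (q * d) r ⟩
      r + q * d    ∎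
  ... | no c≮r = mk⇔
    (λ le → subst (_≤ L) (sym (+-identityʳ q)) (≮⇒≥ λ L<q → <⇒≱ (too-big L<q) le))
    (λ q≤L → begin
       r + q * d    ≤⟨ +-mono-≤ (≮⇒≥ c≮r) (*-monoˡ-≤ d (subst (_≤ L) (+-identityʳ q) q≤L)) ⟩
       c + L * d    ≡⟨ +-comm c (L * d) ⟩
       L * d + c    ∎)
    where
    open ≤-Reasoning
    too-big : L < q → L * d + c < r + q * d
    too-big L<q = begin-strict
      L * d + c    <⟨ +-monoʳ-< (L * d) c<d ⟩
      L * d + d    ≡⟨ +-comm (L * d) d ⟩
      suc L * d    ≤⟨ *-monoˡ-≤ d L<q ⟩
      q * d        ≤⟨ m≤n+m (q * d) r ⟩
      r + q * d    ∎

  divMod-unique : ∀ {d r r′} q q′ .{{_ : NonZero d}} → r < d → r′ < d →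
                  r + q * d ≡ r′ + q′ * d → r ≡ r′ × q ≡ q′
  divMod-unique {d} {r} {r′} q q′ r<d r′<d eq = r≡r′ , q≡q′
    where
    open ≡-Reasoning
    r≡r′ : r ≡ r′
    r≡r′ = begin
      r                  ≡⟨ m<n⇒m%n≡m r<d ⟨
      r % d              ≡⟨ [m+kn]%n≡m%n r q d ⟨
      (r + q * d) % d    ≡⟨ cong (_% d) eq ⟩
      (r′ + q′ * d) % d  ≡⟨ [m+kn]%n≡m%n r′ q′ d ⟩
      r′ % d             ≡⟨ m<n⇒m%n≡m r′<d ⟩
      r′                 ∎
    q≡q′ : q ≡ q′
    q≡q′ = *-cancelʳ-≡ q q′ d (+-cancelˡ-≡ r _ _ (trans eq (cong (_+ q′ * d) (sym r≡r′))))

  sumBelow-+ : ∀ m n f → sumBelow (m + n) f ≡ sumBelow m f + sumBelow n (λ c → f (m + c))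
  sumBelow-+ zero    n f = refl
  sumBelow-+ (suc m) n f = trans (cong (f 0 +_) (sumBelow-+ m n (λ c → f (suc c)))) (sym (+-assoc (f 0) _ _))

  sumBelow-* : ∀ n k f → sumBelow n (λ c → k * f c) ≡ k * sumBelow n f
  sumBelow-* zero    k f = sym (*-zeroʳ k)
  sumBelow-* (suc n) k f = trans (cong (k * f 0 +_) (sumBelow-* n k (λ c → f (suc c)))) (sym (*-distribˡ-+ k (f 0) _))

  sumBelow-const : ∀ n (f : ℕ → ℕ) {u} → (∀ c → c < n → f c ≡ u) → sumBelow n f ≡ n * u
  sumBelow-const zero    f f≡u = refl
  sumBelow-const (suc n) f f≡u = cong₂ _+_ (f≡u 0 z<s) (sumBelow-const n (λ c → f (suc c)) λ c c<n → f≡u (suc c) (s<s c<n))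

  sumBelow-piecewise : ∀ p m q f {u v w} →
    (∀ c → c < p → f c ≡ u) → (∀ c → p ≤ c → c < p + m → f c ≡ v) → (∀ c → p + m ≤ c → c < p + m + q → f c ≡ w) →
    sumBelow (p + m + q) f ≡ p * u + m * v + q * w
  sumBelow-piecewise p m q f {u} {v} {w} on-u on-v on-w = begin
    sumBelow (p + m + q) f
      ≡⟨ sumBelow-+ (p + m) q f ⟩
    sumBelow (p + m) f + sumBelow q (λ c → f (p + m + c))
      ≡⟨ cong (_+ sumBelow q (λ c → f (p + m + c))) (sumBelow-+ p m f) ⟩
    sumBelow p f + sumBelow m (λ c → f (p + c)) + sumBelow q (λ c → f (p + m + c))
      ≡⟨ cong₂ _+_ (cong₂ _+_ (sumBelow-const p f on-u) (sumBelow-const m _ (shifted on-v))) (sumBelow-const q _ (shifted on-w)) ⟩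
    p * u + m * v + q * w ∎
    where
    open ≡-Reasoning
    shifted : ∀ {lo n x} → (∀ c → lo ≤ c → c < lo + n → f c ≡ x) → ∀ c → c < n → f (lo + c) ≡ x
    shifted {lo} on-x c c<n = on-x (lo + c) (m≤m+n lo c) (+-monoʳ-< lo c<n)

  module Carries (d′ i₀ j₀ : ℕ) where
    private
      d = suc d′

    carry : ℕ → ℕ
    carry c = ⟦ c < i₀ ⟧ + ⟦ d′ ∸ c < j₀ ⟧

    private
      ⟦∸<⟧≡0 : ∀ {c} → c + j₀ < d → ⟦ d′ ∸ c < j₀ ⟧ ≡ 0
      ⟦∸<⟧≡0 {c} c+j₀<d = ⟦<⟧≡0 (m+n≤o⇒m≤o∸n j₀ (subst (_≤ d′) (+-comm c j₀) (≤-pred c+j₀<d)))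

      ⟦∸<⟧≡1 : ∀ {c} → d ≤ c + j₀ → c < d → ⟦ d′ ∸ c < j₀ ⟧ ≡ 1
      ⟦∸<⟧≡1 {c} d≤c+j₀ c<d = ⟦<⟧≡1 (subst (d′ ∸ c <_) (m+n∸m≡n c j₀) (∸-monoˡ-< d≤c+j₀ (≤-pred c<d)))

    sumBelow-carry-< : ∀ (h : ℕ → ℕ) base m → i₀ + m + j₀ ≡ d →
                       sumBelow d (λ c → h (base + carry c)) ≡ m * h base + (i₀ + j₀) * h (suc base)
    sumBelow-carry-< h base m total = begin
      sumBelow d f                                ≡⟨ cong (λ n → sumBelow n f) (sym total) ⟩
      sumBelow (i₀ + m + j₀) f                     ≡⟨ sumBelow-piecewise i₀ m j₀ f left middle right ⟩
      i₀ * h (suc base) + m * h base + j₀ * h (suc base) ≡⟨ regroup i₀ m j₀ (h base) (h (suc base)) ⟩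
      m * h base + (i₀ + j₀) * h (suc base)        ∎
      where
      open ≡-Reasoning
      f = λ c → h (base + carry c)
      at : ∀ {c n} → carry c ≡ n → f c ≡ h (base + n)
      at eq = cong (λ n → h (base + n)) eq
      left : ∀ c → c < i₀ → f c ≡ h (suc base)
      left c c<i₀ = trans (at (cong₂ _+_ (⟦<⟧≡1 c<i₀)
                                (⟦∸<⟧≡0 (<-≤-trans (+-monoˡ-< j₀ c<i₀) (subst (i₀ + j₀ ≤_) total (+-monoˡ-≤ j₀ (m≤m+n i₀ m)))))))
                         (cong h (+-comm base 1))
      middle : ∀ c → i₀ ≤ c → c < i₀ + m → f c ≡ h base
      middle c i₀≤c c<i₀+m = trans (at (cong₂ _+_ (⟦<⟧≡0 i₀≤c) (⟦∸<⟧≡0 (subst (c + j₀ <_) total (+-monoˡ-< j₀ c<i₀+m)))))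
                                   (cong h (+-identityʳ base))
      right : ∀ c → i₀ + m ≤ c → c < i₀ + m + j₀ → f c ≡ h (suc base)
      right c i₀+m≤c c<d = trans (at (cong₂ _+_ (⟦<⟧≡0 (≤-trans (m≤m+n i₀ m) i₀+m≤c))
                                      (⟦∸<⟧≡1 (subst (_≤ c + j₀) total (+-monoˡ-≤ j₀ i₀+m≤c)) (subst (c <_) total c<d))))
                              (cong h (+-comm base 1))
      regroup : ∀ i m j x y → i * y + m * x + j * y ≡ m * x + (i + j) * y
      regroup = solve-∀

    sumBelow-carry-≥ : ∀ (h : ℕ → ℕ) base a β e → i₀ ≡ a + β → j₀ ≡ β + e → a + β + e ≡ d →
                       sumBelow d (λ c → h (base + carry c)) ≡ (a + e) * h (suc base) + β * h (2 + base)
    sumBelow-carry-≥ h base a β e i₀≡ j₀≡ total = begin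
      sumBelow d f                                              ≡⟨ cong (λ n → sumBelow n f) (sym total) ⟩
      sumBelow (a + β + e) f                                    ≡⟨ sumBelow-piecewise a β e f left middle right ⟩
      a * h (suc base) + β * h (2 + base) + e * h (suc base)   ≡⟨ regroup a β e (h (suc base)) (h (2 + base)) ⟩
      (a + e) * h (suc base) + β * h (2 + base)                ∎
      where
      open ≡-Reasoning
      f = λ c → h (base + carry c)
      at : ∀ {c n} → carry c ≡ n → f c ≡ h (base + n)
      at eq = cong (λ n → h (base + n)) eq
      a+j₀≡d : a + j₀ ≡ d
      a+j₀≡d = trans (cong (a +_) j₀≡) (trans (sym (+-assoc a β e)) total)
      left : ∀ c → c < a → f c ≡ h (suc base)
      left c c<a = trans (at (cong₂ _+_ (⟦<⟧≡1 (subst (c <_) (sym i₀≡) (<-≤-trans c<a (m≤m+n a β))))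
                                         (⟦∸<⟧≡0 (subst (c + j₀ <_) a+j₀≡d (+-monoˡ-< j₀ c<a)))))
                         (cong h (+-comm base 1))
      middle : ∀ c → a ≤ c → c < a + β → f c ≡ h (2 + base)
      middle c a≤c c<a+β = trans (at (cong₂ _+_ (⟦<⟧≡1 (subst (c <_) (sym i₀≡) c<a+β))
                                                 (⟦∸<⟧≡1 (subst (_≤ c + j₀) a+j₀≡d (+-monoˡ-≤ j₀ a≤c))
                                                         (<-≤-trans c<a+β (subst (a + β ≤_) total (m≤m+n (a + β) e))))))
                                 (cong h (+-comm base 2))
      right : ∀ c → a + β ≤ c → c < a + β + e → f c ≡ h (suc base)
      right c a+β≤c c<d = trans (at (cong₂ _+_ (⟦<⟧≡0 (subst (_≤ c) (sym i₀≡) a+β≤c))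
                                                (⟦∸<⟧≡1 (subst (_≤ c + j₀) a+j₀≡d (+-monoˡ-≤ j₀ (≤-trans (m≤m+n a β) a+β≤c)))
                                                        (subst (c <_) total c<d))))
                                (cong h (+-comm base 1))
      regroup : ∀ a β e x y → a * x + β * y + e * x ≡ (a + e) * x + β * y
      regroup = solve-∀

    overflow-split : ∀ {β} → i₀ < d → j₀ < d → d + β ≡ i₀ + j₀ →
                     i₀ ≡ (d ∸ j₀) + β × j₀ ≡ β + (j₀ ∸ β) × (d ∸ j₀) + β + (j₀ ∸ β) ≡ d
    overflow-split {β} i₀<d j₀<d d+β≡ = i₀≡ , j₀≡ , total
      where
      open ≡-Reasoning
      a = d ∸ j₀
      a+j₀≡d : a + j₀ ≡ d
      a+j₀≡d = m∸n+n≡m (<⇒≤ j₀<d)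
      β≤j₀ : β ≤ j₀
      β≤j₀ = +-cancelˡ-≤ d β j₀ (subst (_≤ d + j₀) (sym d+β≡) (+-monoˡ-≤ j₀ (<⇒≤ i₀<d)))
      j₀≡ : j₀ ≡ β + (j₀ ∸ β)
      j₀≡ = sym (m+[n∸m]≡n β≤j₀)
      swap : ∀ x y z → x + y + z ≡ x + z + y
      swap = solve-∀
      i₀≡ : i₀ ≡ a + β
      i₀≡ = +-cancelʳ-≡ j₀ i₀ (a + β) (begin
        i₀ + j₀      ≡⟨ d+β≡ ⟨
        d + β        ≡⟨ cong (_+ β) a+j₀≡d ⟨
        a + j₀ + β   ≡⟨ swap a j₀ β ⟩
        a + β + j₀   ∎)
      total : a + β + (j₀ ∸ β) ≡ d
      total = trans (+-assoc a β _) (trans (cong (a +_) (sym j₀≡)) a+j₀≡d)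

    sumBelow-carry : ∀ (h : ℕ → ℕ) base {α β} → i₀ < d → j₀ < d → β < d →
                     i₀ + j₀ + base * d ≡ β + α * d →
                     sumBelow d (λ c → h (base + carry c)) ≡ (d ∸ β) * h α + β * h (suc α)
    sumBelow-carry h base {α} {β} i₀<d j₀<d β<d eq with i₀ + j₀ <? d
    ... | yes i₀+j₀<d with divMod-unique base α i₀+j₀<d β<d eq
    ...   | refl , refl = sumBelow-carry-< h base (d ∸ (i₀ + j₀)) (trans (swap i₀ j₀ _) (m+[n∸m]≡n (<⇒≤ i₀+j₀<d)))
      where
      swap : ∀ x y z → x + z + y ≡ x + y + z
      swap = solve-∀
    sumBelow-carry h base {α} {β} i₀<d j₀<d β<d eq | no i₀+j₀≮d
      with divMod-unique (suc base) α overflow<d β<d (trans (regroup d overflow (base * d)) (trans (cong (_+ base * d) d+overflow≡) eq))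
      where
      overflow = i₀ + j₀ ∸ d
      d+overflow≡ : d + overflow ≡ i₀ + j₀
      d+overflow≡ = m+[n∸m]≡n (≮⇒≥ i₀+j₀≮d)
      overflow<d : overflow < d
      overflow<d = +-cancelˡ-< d overflow d (subst (_< d + d) (sym d+overflow≡) (+-mono-< i₀<d j₀<d))
      regroup : ∀ d o x → o + (d + x) ≡ d + o + x
      regroup = solve-∀
    ... | refl , refl =
      let i₀≡ , j₀≡ , total = overflow-split i₀<d j₀<d (m+[n∸m]≡n (≮⇒≥ i₀+j₀≮d))
          a = d ∸ j₀
          e = j₀ ∸ β
          a+e≡d∸β : a + e ≡ d ∸ β
          a+e≡d∸β = trans (sym (m+n∸n≡m (a + e) β)) (cong (_∸ β) (trans (swap a e β) total))
      in trans (sumBelow-carry-≥ h base a β e i₀≡ j₀≡ total) (cong (λ x → x * h (suc base) + β * h (2 + base)) a+e≡d∸β)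
      where
      swap : ∀ x y z → x + y + z ≡ x + z + y
      swap = solve-∀

module Rationals where

  open import Data.Nat as ℕ using (ℕ; suc)
  import Data.Nat.Properties as ℕ
  open import Data.Integer as ℤ using (+_)
  import Data.Integer.Properties as ℤ
  open import Data.Rational using (ℚ; _/_; _+_; _*_; _-_; 1ℚ; 1/_; NonZero; toℚᵘ)
  open import Data.Rational.Properties
    using (toℚᵘ-injective; toℚᵘ-fromℚᵘ; toℚᵘ-homo-+; toℚᵘ-homo-*; *-inverseʳ; *-identityʳ; *-assoc; *-comm; pos⇒nonZero; normalize-pos)
  open import Data.Rational.Unnormalised as ℚᵘ using (mkℚᵘ; *≡*)
  import Data.Rational.Unnormalised.Properties as ℚᵘ
  open import Relation.Binary.PropositionalEquality
  open import Data.Rational.Solver using (module +-*-Solver)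

  ι : ℕ → ℚ
  ι n = + n / 1

  private
    toℚᵘ-/ : ∀ a n → toℚᵘ (+ a / suc n) ℚᵘ.≃ mkℚᵘ (+ a) n
    toℚᵘ-/ a n = toℚᵘ-fromℚᵘ (mkℚᵘ (+ a) n)

  ι-+ : ∀ m n → ι (m ℕ.+ n) ≡ ι m + ι n
  ι-+ m n = toℚᵘ-injective (begin
    toℚᵘ (ι (m ℕ.+ n))                   ≈⟨ toℚᵘ-/ (m ℕ.+ n) 0 ⟩
    mkℚᵘ (+ (m ℕ.+ n)) 0                 ≈⟨ *≡* (cong (ℤ._* + 1) (sym (cong₂ ℤ._+_ (ℤ.*-identityʳ (+ m)) (ℤ.*-identityʳ (+ n))))) ⟩
    mkℚᵘ (+ m) 0 ℚᵘ.+ mkℚᵘ (+ n) 0       ≈⟨ ℚᵘ.+-cong (toℚᵘ-/ m 0) (toℚᵘ-/ n 0) ⟨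
    toℚᵘ (ι m) ℚᵘ.+ toℚᵘ (ι n)           ≈⟨ toℚᵘ-homo-+ (ι m) (ι n) ⟨
    toℚᵘ (ι m + ι n)                     ∎)
    where open ℚᵘ.≃-Reasoning

  ι-* : ∀ m n → ι (m ℕ.* n) ≡ ι m * ι n
  ι-* m n = toℚᵘ-injective (begin
    toℚᵘ (ι (m ℕ.* n))                   ≈⟨ toℚᵘ-/ (m ℕ.* n) 0 ⟩
    mkℚᵘ (+ (m ℕ.* n)) 0                 ≈⟨ *≡* (cong (ℤ._* + 1) (ℤ.pos-* m n)) ⟩
    mkℚᵘ (+ m) 0 ℚᵘ.* mkℚᵘ (+ n) 0       ≈⟨ ℚᵘ.*-cong (toℚᵘ-/ m 0) (toℚᵘ-/ n 0) ⟨
    toℚᵘ (ι m) ℚᵘ.* toℚᵘ (ι n)           ≈⟨ toℚᵘ-homo-* (ι m) (ι n) ⟨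
    toℚᵘ (ι m * ι n)                     ∎)
    where open ℚᵘ.≃-Reasoning

  ι-*-/ : ∀ a n → ι (suc n) * (+ a / suc n) ≡ ι a
  ι-*-/ a n = toℚᵘ-injective (begin
    toℚᵘ (ι (suc n) * (+ a / suc n))            ≈⟨ toℚᵘ-homo-* (ι (suc n)) (+ a / suc n) ⟩
    toℚᵘ (ι (suc n)) ℚᵘ.* toℚᵘ (+ a / suc n)    ≈⟨ ℚᵘ.*-cong (toℚᵘ-/ (suc n) 0) (toℚᵘ-/ a n) ⟩
    mkℚᵘ (+ suc n) 0 ℚᵘ.* mkℚᵘ (+ a) n
      ≈⟨ *≡* (trans (ℤ.*-identityʳ _) (trans (ℤ.*-comm (+ suc n) (+ a)) (cong (λ k → + a ℤ.* + suc k) (sym (ℕ.+-identityʳ n))))) ⟩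
    mkℚᵘ (+ a) 0                                ≈⟨ toℚᵘ-/ a 0 ⟨
    toℚᵘ (ι a)                                  ∎)
    where open ℚᵘ.≃-Reasoning

  ι-nonZero : ∀ n → NonZero (ι (suc n))
  ι-nonZero n = pos⇒nonZero (ι (suc n)) {{normalize-pos (suc n) 1}}

  /≡*1/ : ∀ a n → + a / suc n ≡ ι a * (1/ ι (suc n)) {{ι-nonZero n}}
  /≡*1/ a n = begin
    x                          ≡⟨ *-identityʳ x ⟨
    x * 1ℚ                     ≡⟨ cong (x *_) (*-inverseʳ c) ⟨
    x * (c * 1/ c)             ≡⟨ *-assoc x c (1/ c) ⟨
    (x * c) * 1/ c             ≡⟨ cong (_* 1/ c) (*-comm x c) ⟩
    (c * x) * 1/ c             ≡⟨ cong (_* 1/ c) (ι-*-/ a n) ⟩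
    ι a * 1/ c                 ∎
    where
    open ≡-Reasoning
    x = + a / suc n
    c = ι (suc n)
    instance
      c≢0 : NonZero c
      c≢0 = ι-nonZero n

  formula-identity : ∀ d′ m D X Z N β P → P ℕ.* X ≡ suc m ℕ.* Z → N ℕ.+ D ℕ.* β ℕ.* Z ≡ suc d′ ℕ.* D ℕ.* X →
                     ι N ≡ ι (suc d′ ℕ.* D) * (1ℚ - (+ β / suc d′) * (+ P / suc m)) * ι X
  formula-identity d′ m D X Z N β P PX≡mZ N+DβZ≡dDX = begin
    ι N
      ≡⟨ solve 4 (λ n D b z → n := (n :+ D :* b :* z) :- D :* b :* z :* con 1ℚ) refl (ι N) (ι D) (ι β) (ι Z) ⟩
    (ι N + ι D * ι β * ι Z) - ι D * ι β * ι Z * 1ℚ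
      ≡⟨ cong₂ (λ l r → l - ι D * ι β * ι Z * r) N+DβZ≡dDX′ (sym (*-inverseʳ mm)) ⟩
    a * ι D * ι X - ι D * ι β * ι Z * (mm * z)
      ≡⟨ solve 7 (λ a D X b Z mm z → a :* D :* X :- D :* b :* Z :* (mm :* z)
                                    := a :* D :* X :- D :* b :* con 1ℚ :* (mm :* Z) :* z)
                 refl a (ι D) (ι X) (ι β) (ι Z) mm z ⟩
    a * ι D * ι X - ι D * ι β * 1ℚ * (mm * ι Z) * z
      ≡⟨ cong₂ (λ l r → a * ι D * ι X - ι D * ι β * l * r * z) (sym (*-inverseʳ a)) (sym PX≡mZ′) ⟩
    a * ι D * ι X - ι D * ι β * (a * y) * (ι P * ι X) * z
      ≡⟨ solve 7 (λ a D X b y p z → a :* D :* X :- D :* b :* (a :* y) :* (p :* X) :* z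
                                   := a :* D :* (con 1ℚ :- b :* y :* (p :* z)) :* X)
                 refl a (ι D) (ι X) (ι β) y (ι P) z ⟩
    a * ι D * (1ℚ - ι β * y * (ι P * z)) * ι X
      ≡⟨ cong₂ (λ l r → l * (1ℚ - r) * ι X) (sym (ι-* (suc d′) D)) (sym (cong₂ _*_ (/≡*1/ β d′) (/≡*1/ P m))) ⟩
    ι (suc d′ ℕ.* D) * (1ℚ - (+ β / suc d′) * (+ P / suc m)) * ι X ∎
    where
    open ≡-Reasoning
    open +-*-Solver
    a = ι (suc d′)
    mm = ι (suc m)
    instance
      a≢0 : NonZero a
      a≢0 = ι-nonZero d′
      mm≢0 : NonZero mm
      mm≢0 = ι-nonZero m
    y = 1/ a
    z = 1/ mm
    PX≡mZ′ : ι P * ι X ≡ mm * ι Z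
    PX≡mZ′ = trans (sym (ι-* P X)) (trans (cong ι PX≡mZ) (ι-* (suc m) Z))
    N+DβZ≡dDX′ : ι N + ι D * ι β * ι Z ≡ a * ι D * ι X
    N+DβZ≡dDX′ = begin
      ι N + ι D * ι β * ι Z               ≡⟨ cong (_+_ (ι N)) (trans (ι-* (D ℕ.* β) Z) (cong (_* ι Z) (ι-* D β))) ⟨
      ι N + ι (D ℕ.* β ℕ.* Z)             ≡⟨ ι-+ N _ ⟨
      ι (N ℕ.+ D ℕ.* β ℕ.* Z)             ≡⟨ cong ι N+DβZ≡dDX ⟩
      ι (suc d′ ℕ.* D ℕ.* X)              ≡⟨ trans (ι-* (suc d′ ℕ.* D) X) (cong (_* ι X) (ι-* (suc d′) D)) ⟩
      a * ι D * ι X                       ∎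

module Formula (d′ n ℓ′ : ℕ) where

  open import Data.Nat using (zero; suc; _+_; _*_; _∸_; _^_; _<_; _≤?_; z<s; pred; NonZero)
  open import Data.Nat.Properties
  open import Data.Nat.Combinatorics using (_C_; nCk+nC[k+1]≡[n+1]C[k+1]; nCk≡nC[n∸k])
  open import Data.Nat.Combinatorics.Specification using (k>n⇒nCk≡0)
  open import Relation.Nullary using (yes; no)
  open import Relation.Binary.PropositionalEquality
  open import Data.Nat.Tactic.RingSolver using (solve-∀)
  open import Defs using (formula)
  open import Data.Integer using (+_)
  open import Data.Rational as ℚ using (0ℚ; 1ℚ; _/_)
  open Counting using (shifted; shifted-+; shifted-<)
  open Binomial using (C-absorption)
  open Rationals using (ι; formula-identity)
  open Forests d′ using (framedCount; framedCount-closed)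

  d : ℕ
  d = suc d′

  H : ℕ → ℕ
  H e = (suc d * n ∸ e) C (d * n + suc ℓ′)

  H-closed : ∀ E R t → R ≡ suc (suc d * suc ℓ′ + E * d) → n ≡ ℓ′ + suc E + t → framedCount R t ≡ H E
  H-closed E R t R≡ n≡ = begin
    framedCount R t            ≡⟨ framedCount-closed R t ⟩
    (suc d * t + R ∸ 1) C t    ≡⟨ cong (_C t) top≡ ⟩
    (t + P) C t                ≡⟨ nCk≡nC[n∸k] (m≤m+n t P) ⟩
    (t + P) C (t + P ∸ t)      ≡⟨ cong ((t + P) C_) (m+n∸m≡n t P) ⟩
    (t + P) C P                ≡⟨ cong (_C P) M≡ ⟨
    H E                        ∎
    where
    open ≡-Reasoning
    P = d * n + suc ℓ′
    expand₁ : ∀ d ℓ E t → suc d * t + (suc d * suc ℓ + E * d) ≡ t + (d * (ℓ + suc E + t) + suc ℓ)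
    expand₁ = solve-∀
    expand₂ : ∀ d ℓ E t → suc d * (ℓ + suc E + t) ≡ E + (t + (d * (ℓ + suc E + t) + suc ℓ))
    expand₂ = solve-∀
    top≡ : suc d * t + R ∸ 1 ≡ t + P
    top≡ = begin
      suc d * t + R ∸ 1                               ≡⟨ cong (λ r → suc d * t + r ∸ 1) R≡ ⟩
      suc d * t + suc (suc d * suc ℓ′ + E * d) ∸ 1    ≡⟨ cong (_∸ 1) (+-suc (suc d * t) _) ⟩
      suc d * t + (suc d * suc ℓ′ + E * d)            ≡⟨ expand₁ d ℓ′ E t ⟩
      t + (d * (ℓ′ + suc E + t) + suc ℓ′)             ≡⟨ cong (λ m → t + (d * m + suc ℓ′)) n≡ ⟨
      t + P                                           ∎
    M≡ : suc d * n ∸ E ≡ t + P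
    M≡ = begin
      suc d * n ∸ E                                       ≡⟨ cong (λ m → suc d * m ∸ E) n≡ ⟩
      suc d * (ℓ′ + suc E + t) ∸ E                        ≡⟨ cong (_∸ E) (expand₂ d ℓ′ E t) ⟩
      E + (t + (d * (ℓ′ + suc E + t) + suc ℓ′)) ∸ E       ≡⟨ m+n∸m≡n E _ ⟩
      t + (d * (ℓ′ + suc E + t) + suc ℓ′)                 ≡⟨ cong (λ m → t + (d * m + suc ℓ′)) n≡ ⟨
      t + P                                               ∎

  H-vanishes : ∀ E → n < ℓ′ + suc E → H E ≡ 0
  H-vanishes E n<c = k>n⇒nCk≡0 (m<n+o⇒m∸n<o (suc d * n) E (subst (suc d * n <_) (regroup d n ℓ′ E) (+-monoˡ-< (d * n) n<c)))
    where
    instance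
      P≢0 : NonZero (d * n + suc ℓ′)
      P≢0 = subst NonZero (sym (+-suc (d * n) ℓ′)) _
    regroup : ∀ d n ℓ E → ℓ + suc E + d * n ≡ E + (d * n + suc ℓ)
    regroup = solve-∀

  shifted-framedCount : ∀ E R → R ≡ suc (suc d * suc ℓ′ + E * d) → shifted (framedCount R) (ℓ′ + suc E) n ≡ H E
  shifted-framedCount E R R≡ with ℓ′ + suc E ≤? n
  ... | yes c≤n = trans (cong (shifted (framedCount R) c) n≡) (trans (shifted-+ (framedCount R) c t) (H-closed E R t R≡ n≡))
    where
    c = ℓ′ + suc E
    t = n ∸ c
    n≡ : n ≡ c + t
    n≡ = sym (m+[n∸m]≡n c≤n)
  ... | no c≰n = trans (shifted-< (framedCount R) (≰⇒> c≰n)) (sym (H-vanishes E (≰⇒> c≰n)))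

  formula-zero : ∀ α β → suc d * n ∸ α ≡ 0 → formula d n (suc ℓ′) α β ≡ 0ℚ
  formula-zero α β M≡0 rewrite M≡0 = refl

  formula-suc : ∀ α β m → suc d * n ∸ α ≡ suc m →
                formula d n (suc ℓ′) α β
                  ≡ ι (d ^ suc ℓ′) ℚ.* (1ℚ ℚ.- (+ β / d) ℚ.* (+ (d * n + suc ℓ′) / suc m)) ℚ.* ι (suc m C (d * n + suc ℓ′))
  formula-suc α β m M≡ rewrite M≡ = refl

  H[1+α] : ∀ {α M} → suc d * n ∸ α ≡ M → H (suc α) ≡ pred M C (d * n + suc ℓ′)
  H[1+α] {α} M≡ = cong (_C (d * n + suc ℓ′)) (trans (sym (pred[m∸n]≡m∸[1+n] (suc d * n) α)) (cong pred M≡))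

  formula-value-zero : ∀ α β → suc d * n ∸ α ≡ 0 → ι (d ^ ℓ′ * ((d ∸ β) * H α + β * H (suc α))) ≡ formula d n (suc ℓ′) α β
  formula-value-zero α β M≡0 = trans (cong ι (begin
    D * ((d ∸ β) * H α + β * H (suc α))
      ≡⟨ cong₂ (λ x y → D * ((d ∸ β) * x + β * y)) (trans (cong (_C P) M≡0) 0CP≡0) (trans (H[1+α] M≡0) 0CP≡0) ⟩
    D * ((d ∸ β) * 0 + β * 0)             ≡⟨ cong (D *_) (cong₂ _+_ (*-zeroʳ (d ∸ β)) (*-zeroʳ β)) ⟩
    D * 0                                 ≡⟨ *-zeroʳ D ⟩
    0                                     ∎)) (sym (formula-zero α β M≡0))
    where
    open ≡-Reasoning
    P = d * n + suc ℓ′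
    D = d ^ ℓ′
    0CP≡0 : 0 C P ≡ 0
    0CP≡0 = k>n⇒nCk≡0 (subst (0 <_) (sym (+-suc (d * n) ℓ′)) z<s)

  formula-value-suc : ∀ α β m → β < d → suc d * n ∸ α ≡ suc m →
                      ι (d ^ ℓ′ * ((d ∸ β) * H α + β * H (suc α))) ≡ formula d n (suc ℓ′) α β
  formula-value-suc α β m β<d M≡ = begin
    ι (D * ((d ∸ β) * H α + β * H (suc α)))
      ≡⟨ cong ι (cong₂ (λ x y → D * ((d ∸ β) * x + β * y)) (cong (_C P) M≡) (H[1+α] M≡)) ⟩
    ι (D * ((d ∸ β) * X + β * Y))                                ≡⟨ formula-identity d′ m D X Z _ β P P*X≡ N+DβZ≡ ⟩
    ι (d * D) ℚ.* (1ℚ ℚ.- (+ β / d) ℚ.* (+ P / suc m)) ℚ.* ι X  ≡⟨ formula-suc α β m M≡ ⟨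
    formula d n (suc ℓ′) α β                                     ∎
    where
    open ≡-Reasoning
    P = d * n + suc ℓ′
    p = d * n + ℓ′
    D = d ^ ℓ′
    X = suc m C P
    Y = m C P
    Z = m C p
    P≡ : P ≡ suc p
    P≡ = +-suc (d * n) ℓ′
    X≡Z+Y : X ≡ Z + Y
    X≡Z+Y = begin
      suc m C P          ≡⟨ cong (suc m C_) P≡ ⟩
      suc m C suc p      ≡⟨ nCk+nC[k+1]≡[n+1]C[k+1] m p ⟨
      m C p + m C suc p  ≡⟨ cong (λ q → Z + m C q) P≡ ⟨
      Z + Y              ∎
    P*X≡ : P * X ≡ suc m * Z
    P*X≡ = trans (cong₂ (λ q r → q * (suc m C r)) P≡ P≡) (C-absorption m p)
    regroup : ∀ D w b y z → D * (w * (z + y) + b * y) + D * b * z ≡ (w + b) * D * (z + y)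
    regroup = solve-∀
    N+DβZ≡ : D * ((d ∸ β) * X + β * Y) + D * β * Z ≡ d * D * X
    N+DβZ≡ = begin
      D * ((d ∸ β) * X + β * Y) + D * β * Z           ≡⟨ cong (λ x → D * ((d ∸ β) * x + β * Y) + D * β * Z) X≡Z+Y ⟩
      D * ((d ∸ β) * (Z + Y) + β * Y) + D * β * Z     ≡⟨ regroup D (d ∸ β) β Y Z ⟩
      ((d ∸ β) + β) * D * (Z + Y)                     ≡⟨ cong₂ (λ e x → e * D * x) (m∸n+n≡m (<⇒≤ β<d)) (sym X≡Z+Y) ⟩
      d * D * X                                       ∎

  formula-value : ∀ α β → β < d → ι (d ^ ℓ′ * ((d ∸ β) * H α + β * H (suc α))) ≡ formula d n (suc ℓ′) α β
  formula-value α β β<d = by-cases (suc d * n ∸ α) refl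
    where
    by-cases : ∀ M → suc d * n ∸ α ≡ M → ι (d ^ ℓ′ * ((d ∸ β) * H α + β * H (suc α))) ≡ formula d n (suc ℓ′) α β
    by-cases zero    M≡ = formula-value-zero α β M≡
    by-cases (suc m) M≡ = formula-value-suc α β m β<d M≡

open import Data.Nat using (suc; _+_; _*_; _<_)
open import Relation.Binary.PropositionalEquality using (_≡_)

module Pairs (d′ n k′ ℓ′ : ℕ) {i j i₀ i₁ j₀ j₁ : ℕ}
                (i₀<d : i₀ < suc d′) (j₀<d : j₀ < suc d′)
                (i≡ : i ≡ i₀ + i₁ * suc d′) (j≡ : j ≡ j₀ + j₁ * suc d′) where

  open import Data.Nat using (_∸_; _^_; _≤_; s≤s; s≤s⁻¹)
  open import Data.Nat.Properties
  open import Data.Fin using (Fin; toℕ)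
  open import Data.Fin.Properties using (toℕ<n)
  open import Data.List using (List; _∷_; length)
  open import Data.Vec using (Vec; _∷_)
  import Data.Vec as Vec
  open import Data.Product using (Σ; _×_; _,_; proj₁; proj₂; uncurry)
  open import Data.Product.Algebra using (Σ-assoc; ×-cong)
  open import Function.Bundles using (_↔_; _⇔_; mk⇔; mk↔ₛ′; Inverse; Equivalence)
  open import Function.Properties.Inverse using (↔-refl; ↔-trans)
  import Relation.Unary as U
  open import Relation.Binary.PropositionalEquality
  open import Data.Nat.Tactic.RingSolver using (solve-∀)
  open import Defs
  open Counting
  open Splitting using (AtLeast; Σ-nonempty-↔; ++-↔)
  open Digits using (⟦_<_⟧; digits-≤; sumBelow-*; module Carries)
  open Zipper d′
  open Forests d′
  open Formula d′ n ℓ′ using (H; shifted-framedCount)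

  open Inverse
  open Carries d′ i₀ j₀ using (carry; sumBelow-carry)

  k ℓ : ℕ
  k = k′ * d
  ℓ = suc ℓ′

  Conditions : PointedTree → Set
  Conditions (_ , v) = i ≤ elder v × j ≤ younger v × ℓ ≤ level v × k ≤ children v

  conditions-irrelevant : U.Irrelevant Conditions
  conditions-irrelevant (a , b , c , e) (a′ , b′ , c′ , e′) =
    cong₂ _,_ (≤-irrelevant a a′) (cong₂ _,_ (≤-irrelevant b b′) (cong₂ _,_ (≤-irrelevant c c′) (≤-irrelevant e e′)))

  Admissible : Set
  Admissible = Σ PointedTree Conditions

  admissibleSize : Admissible → ℕ
  admissibleSize ((T , _) , _) = tuplets T

  pair-↔ : Pair d n i j k ℓ ↔ Fibre admissibleSize n
  pair-↔ = mk↔ₛ′ (λ (pair T s v e y c l) → ((T , v) , e , y , l , c) , s)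
                 (λ (((T , v) , e , y , l , c) , s) → pair T s v e y c l)
                 (λ _ → refl) (λ _ → refl)

  elderTuplets youngerTuplets : Fin d → ℕ
  elderTuplets b   = i₁ + ⟦ toℕ b < i₀ ⟧
  youngerTuplets b = j₁ + ⟦ d′ ∸ toℕ b < j₀ ⟧

  Raw : Set
  Raw = List Tuplet × List Tuplet × Vec (Tree d) d′ × List Frame × List Tuplet

  Fits : Fin d → Raw → Set
  Fits b (bef , aft , _ , fs , vts) =
    elderTuplets b ≤ length bef × youngerTuplets b ≤ length aft × ℓ′ ≤ length fs × k′ ≤ length vts

  placed : Fin d → Raw → PointedTree
  placed b (bef , aft , rest , fs , vts) = zipUp ((bef , aft , b , rest) ∷ fs) (node vts , root)

  conditions⇔fits : ∀ b r → Conditions (placed b r) ⇔ Fits b r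
  conditions⇔fits b r@(bef , aft , rest , fs , vts) = mk⇔
    (λ (e , y , l , c) → to elder⇔ e , to younger⇔ y , to level⇔ l , to children⇔ c)
    (λ (e , y , l , c) → from elder⇔ e , from younger⇔ y , from level⇔ l , from children⇔ c)
    where
    open Equivalence
    f = (bef , aft , b , rest)
    v = proj₂ (placed b r)
    elder⇔ : i ≤ elder v ⇔ elderTuplets b ≤ length bef
    elder⇔ = subst₂ (λ i′ e → (i′ ≤ e) ⇔ (elderTuplets b ≤ length bef))
                    (sym i≡) (sym (elderAux-zipUp 0 f fs (node vts , root)))
                    (digits-≤ i₁ (length bef) i₀<d (toℕ<n b))
    younger⇔ : j ≤ younger v ⇔ youngerTuplets b ≤ length aft
    younger⇔ = subst₂ (λ j′ y → (j′ ≤ y) ⇔ (youngerTuplets b ≤ length aft))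
                      (sym j≡) (sym (youngerAux-zipUp 0 f fs (node vts , root)))
                      (digits-≤ j₁ (length aft) j₀<d (s≤s (m∸n≤m d′ (toℕ b))))
    level⇔ : ℓ ≤ level v ⇔ ℓ′ ≤ length fs
    level⇔ = subst (λ l → (ℓ ≤ l) ⇔ (ℓ′ ≤ length fs))
                   (sym (trans (level-zipUp (f ∷ fs) (node vts , root)) (+-identityʳ _)))
                   (mk⇔ s≤s⁻¹ s≤s)
    children⇔ : k ≤ children v ⇔ k′ ≤ length vts
    children⇔ = subst (λ c → (k ≤ c) ⇔ (k′ ≤ length vts))
                      (sym (trans (children-zipUp (f ∷ fs) (node vts , root)) (*-comm d (length vts))))
                      (mk⇔ (*-cancelʳ-≤ k′ (length vts) d) (*-monoˡ-≤ d))

  fits-irrelevant : ∀ b → U.Irrelevant (Fits b)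
  fits-irrelevant b (a , c , e , f) (a′ , c′ , e′ , f′) =
    cong₂ _,_ (≤-irrelevant a a′) (cong₂ _,_ (≤-irrelevant c c′) (cong₂ _,_ (≤-irrelevant e e′) (≤-irrelevant f f′)))

  raw-↔ : (Frame × List Frame × Tree d) ↔ (Fin d × Raw)
  raw-↔ = mk↔ₛ′ to′ from′ (λ _ → refl) (λ { (_ , _ , node _) → refl })
    where
    to′ : Frame × List Frame × Tree d → Fin d × Raw
    to′ ((bef , aft , b , rest) , fs , node vts) = b , bef , aft , rest , fs , vts

    from′ : Fin d × Raw → Frame × List Frame × Tree d
    from′ (b , bef , aft , rest , fs , vts) = (bef , aft , b , rest) , fs , node vts

  admissible-↔ : Admissible ↔ Σ (Fin d) (λ b → Σ Raw (Fits b))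
  admissible-↔ =
    ↔-trans (Σ-pullback-↔ zipper-↔ conditions-irrelevant)
    (↔-trans (Σ-nonempty-↔ λ { _ (_ , _ , () , _) })
    (↔-trans (Σ-subset-↔ raw-↔ {Q = uncurry Fits} conditions-irrelevant (λ {(b , r)} → fits-irrelevant b {r})
               (λ { {(bef , aft , b , rest) , fs , node vts} c → Equivalence.to (conditions⇔fits b (bef , aft , rest , fs , vts)) c })
               (λ { {b , r} c → Equivalence.from (conditions⇔fits b r) c }))
    Σ-assoc))

  rawSize : Fin d → Raw → ℕ
  rawSize b r = tuplets (proj₁ (placed b r))

  forced : Fin d → ℕ
  forced b = elderTuplets b + (youngerTuplets b + k′)

  -- The trees of the final framed forest: the free lists of tuplets before, after and below the
  -- vertex (as three trees), its d − 1 siblings, and the subtrees of the forced tuplets and frames.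
  roots : Fin d → ℕ
  roots b = 3 + d′ + (elderTuplets b * d + (youngerTuplets b * d + (k′ * d + ℓ′ * suc d)))

  gather-↔ : ∀ a c → ((Vec (Tree d) (a * d) × Tree d) × (Vec (Tree d) (c * d) × Tree d) × Vec (Tree d) d′ ×
                      ((Vec (Fin d) ℓ′ × Vec (Tree d) (ℓ′ * suc d)) × List Frame) × (Vec (Tree d) (k′ * d) × Tree d))
                     ↔ (Vec (Fin d) ℓ′ × FramedForest (3 + d′ + (a * d + (c * d + (k′ * d + ℓ′ * suc d)))))
  gather-↔ a c = ↔-trans reorder (×-cong ↔-refl (×-cong (↔-trans (×-cong roots-↔ forced-↔) ++-↔) ↔-refl))
    where
    reorder = mk↔ₛ′ (λ ((fa , tb) , (fc , ta) , rest , ((cs , ff) , fs) , (fk , tv)) → cs , ((tb , ta , tv , rest) , (fa , fc , fk , ff)) , fs)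
                    (λ (cs , ((tb , ta , tv , rest) , (fa , fc , fk , ff)) , fs) → (fa , tb) , (fc , ta) , rest , ((cs , ff) , fs) , (fk , tv))
                    (λ _ → refl) (λ _ → refl)
    roots-↔ : (Tree d × Tree d × Tree d × Vec (Tree d) d′) ↔ Vec (Tree d) (3 + d′)
    roots-↔ = mk↔ₛ′ (λ (t₁ , t₂ , t₃ , ts) → t₁ ∷ t₂ ∷ t₃ ∷ ts) unroot (λ { (_ ∷ _ ∷ _ ∷ _) → refl }) (λ _ → refl)
      where
      unroot : Vec (Tree d) (3 + d′) → Tree d × Tree d × Tree d × Vec (Tree d) d′
      unroot (t₁ ∷ t₂ ∷ t₃ ∷ ts) = t₁ , t₂ , t₃ , ts
    forced-↔ : (Vec (Tree d) (a * d) × Vec (Tree d) (c * d) × Vec (Tree d) (k′ * d) × Vec (Tree d) (ℓ′ * suc d))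
               ↔ Vec (Tree d) (a * d + (c * d + (k′ * d + ℓ′ * suc d)))
    forced-↔ = ↔-trans (×-cong ↔-refl (×-cong ↔-refl ++-↔)) (↔-trans (×-cong ↔-refl ++-↔) ++-↔)

  fits-↔ : ∀ b → Σ Raw (Fits b) ↔ (Vec (Fin d) ℓ′ × FramedForest (roots b))
  fits-↔ b = ↔-trans split
    (↔-trans (×-cong (atLeast-tuplets-↔ (elderTuplets b)) (×-cong (atLeast-tuplets-↔ (youngerTuplets b))
               (×-cong ↔-refl (×-cong (atLeast-frames-↔ ℓ′) (atLeast-tuplets-↔ k′)))))
    (gather-↔ (elderTuplets b) (youngerTuplets b)))
    where
    split : Σ Raw (Fits b) ↔ (AtLeast (elderTuplets b) Tuplet × AtLeast (youngerTuplets b) Tuplet × Vec (Tree d) d′ ×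
                              AtLeast ℓ′ Frame × AtLeast k′ Tuplet)
    split = mk↔ₛ′ (λ ((bef , aft , rest , fs , vts) , p₁ , p₂ , p₃ , p₄) → (bef , p₁) , (aft , p₂) , rest , (fs , p₃) , (vts , p₄))
                  (λ ((bef , p₁) , (aft , p₂) , rest , (fs , p₃) , (vts , p₄)) → (bef , aft , rest , fs , vts) , p₁ , p₂ , p₃ , p₄)
                  (λ _ → refl) (λ _ → refl)

  gather-size : ∀ a c fa tb fc ta rest cs ff free fk tv →
    framedSize (proj₂ (to (gather-↔ a c) ((fa , tb) , (fc , ta) , rest , ((cs , ff) , free) , (fk , tv))))
      ≡ (tuplets tb + (tuplets ta + (tuplets tv + tupletsV rest))) + (tupletsV fa + (tupletsV fc + (tupletsV fk + tupletsV ff)))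
        + framesSize free
  gather-size a c fa tb fc ta rest cs ff free fk tv = cong (_+ framesSize free) (begin
    tupletsV ((tb ∷ ta ∷ tv ∷ rest) Vec.++ (fa Vec.++ (fc Vec.++ (fk Vec.++ ff))))
      ≡⟨ tupletsV-++ (tb ∷ ta ∷ tv ∷ rest) _ ⟩
    tupletsV (tb ∷ ta ∷ tv ∷ rest) + tupletsV (fa Vec.++ (fc Vec.++ (fk Vec.++ ff)))
      ≡⟨ cong (tupletsV (tb ∷ ta ∷ tv ∷ rest) +_)
              (trans (tupletsV-++ fa _) (cong (tupletsV fa +_) (trans (tupletsV-++ fc _) (cong (tupletsV fc +_) (tupletsV-++ fk ff))))) ⟩
    tupletsV (tb ∷ ta ∷ tv ∷ rest) + (tupletsV fa + (tupletsV fc + (tupletsV fk + tupletsV ff))) ∎)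
    where open ≡-Reasoning

  fits-size : ∀ b (x : Σ Raw (Fits b)) → rawSize b (proj₁ x) ≡ (ℓ′ + suc (forced b)) + framedSize (proj₂ (to (fits-↔ b) x))
  fits-size b ((bef , aft , rest , fs , vts) , p₁ , p₂ , p₃ , p₄) = begin
    rawSize b (bef , aft , rest , fs , vts)
      ≡⟨ tuplets-zipUp ((bef , aft , b , rest) ∷ fs) (node vts , root) ⟩
    suc (tuplets (node bef) + (tuplets (node aft) + tupletsV rest)) + framesSize fs + tuplets (node vts)
      ≡⟨ cong₂ _+_ (cong₂ _+_ (cong suc (cong₂ _+_ (atLeast-tuplets-size A (bef , p₁))
                                                    (cong (_+ tupletsV rest) (atLeast-tuplets-size C (aft , p₂)))))
                              (atLeast-frames-size ℓ′ (fs , p₃)))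
                   (atLeast-tuplets-size k′ (vts , p₄)) ⟩
    suc (A + (tupletsV fa + tuplets tb) + (C + (tupletsV fc + tuplets ta) + tupletsV rest))
      + (ℓ′ + (tupletsV ff + framesSize free)) + (k′ + (tupletsV fk + tuplets tv))
      ≡⟨ regroup A C k′ ℓ′ (tupletsV fa) (tupletsV fc) (tupletsV fk) (tupletsV ff)
                 (tuplets tb) (tuplets ta) (tuplets tv) (tupletsV rest) (framesSize free) ⟩
    ℓ′ + suc (forced b) + ((tuplets tb + (tuplets ta + (tuplets tv + tupletsV rest)))
                            + (tupletsV fa + (tupletsV fc + (tupletsV fk + tupletsV ff))) + framesSize free)
      ≡⟨ cong (ℓ′ + suc (forced b) +_) (gather-size A C fa tb fc ta rest cs ff free fk tv) ⟨
    ℓ′ + suc (forced b) + framedSize (proj₂ (to (fits-↔ b) ((bef , aft , rest , fs , vts) , p₁ , p₂ , p₃ , p₄))) ∎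
    where
    open ≡-Reasoning
    A = elderTuplets b
    C = youngerTuplets b
    fa = proj₁ (to (atLeast-tuplets-↔ A) (bef , p₁))
    tb = proj₂ (to (atLeast-tuplets-↔ A) (bef , p₁))
    fc = proj₁ (to (atLeast-tuplets-↔ C) (aft , p₂))
    ta = proj₂ (to (atLeast-tuplets-↔ C) (aft , p₂))
    cs = proj₁ (proj₁ (to (atLeast-frames-↔ ℓ′) (fs , p₃)))
    ff = proj₂ (proj₁ (to (atLeast-frames-↔ ℓ′) (fs , p₃)))
    free = proj₂ (to (atLeast-frames-↔ ℓ′) (fs , p₃))
    fk = proj₁ (to (atLeast-tuplets-↔ k′) (vts , p₄))
    tv = proj₂ (to (atLeast-tuplets-↔ k′) (vts , p₄))
    regroup : ∀ A C K L a c k f b₁ b₂ b₃ r s →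
      suc (A + (a + b₁) + (C + (c + b₂) + r)) + (L + (f + s)) + (K + (k + b₃))
        ≡ L + suc (A + (C + K)) + ((b₁ + (b₂ + (b₃ + r))) + (a + (c + (k + f))) + s)
    regroup = solve-∀

  base : ℕ
  base = i₁ + (j₁ + k′)

  count : ℕ → ℕ
  count c = d ^ ℓ′ * H (base + carry c)

  fits-count : ∀ b → Fibre (λ (x : Σ Raw (Fits b)) → rawSize b (proj₁ x)) n ↔ Fin (count (toℕ b))
  fits-count b = ↔-trans (fibre-↔ (fits-↔ b) (fits-size b))
    (↔-trans Σ-assoc (count-cong count≡
      (×-count (Vec-count ↔-refl ℓ′) (fibre-shifted-count (framedForest-count (roots b)) (ℓ′ + suc (forced b)) n))))
    where
    roots≡ : roots b ≡ suc (suc d * suc ℓ′ + forced b * d)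
    roots≡ = expand d′ ℓ′ (elderTuplets b) (youngerTuplets b) k′
      where
      expand : ∀ d′ ℓ′ a c k → 3 + d′ + (a * suc d′ + (c * suc d′ + (k * suc d′ + ℓ′ * suc (suc d′))))
                                ≡ suc (suc (suc d′) * suc ℓ′ + (a + (c + k)) * suc d′)
      expand = solve-∀
    forced≡ : forced b ≡ base + carry (toℕ b)
    forced≡ = regroup i₁ j₁ k′ ⟦ toℕ b < i₀ ⟧ ⟦ d′ ∸ toℕ b < j₀ ⟧
      where
      regroup : ∀ i j k x y → i + x + (j + y + k) ≡ i + (j + k) + (x + y)
      regroup = solve-∀
    count≡ : d ^ ℓ′ * shifted (framedCount (roots b)) (ℓ′ + suc (forced b)) n ≡ count (toℕ b)
    count≡ = cong (d ^ ℓ′ *_) (trans (shifted-framedCount (forced b) (roots b) roots≡) (cong H forced≡))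

  pairs-↔ : Pair d n i j k ℓ ↔ Fin (sumBelow d count)
  pairs-↔ = ↔-trans pair-↔ (↔-trans (fibre-↔ admissible-↔ (size-law-from admissible-↔ λ _ → refl))
                            (↔-trans Σ-assoc (ΣFin-count d count fits-count)))

  sumBelow-count : ∀ {α β} → β < d → i + j + k ≡ α * d + β → sumBelow d count ≡ d ^ ℓ′ * ((d ∸ β) * H α + β * H (suc α))
  sumBelow-count {α} {β} β<d i+j+k≡ =
    trans (sumBelow-* d (d ^ ℓ′) λ c → H (base + carry c)) (cong (d ^ ℓ′ *_) (sumBelow-carry H base i₀<d j₀<d β<d digits≡))
    where
    digits≡ : i₀ + j₀ + base * d ≡ β + α * d
    digits≡ = begin
      i₀ + j₀ + base * d                     ≡⟨ regroup i₀ i₁ j₀ j₁ k′ d ⟩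
      (i₀ + i₁ * d) + (j₀ + j₁ * d) + k′ * d  ≡⟨ cong₂ (λ x y → x + y + k) i≡ j≡ ⟨
      i + j + k                              ≡⟨ i+j+k≡ ⟩
      α * d + β                              ≡⟨ +-comm (α * d) β ⟩
      β + α * d                              ∎
      where
      open ≡-Reasoning
      regroup : ∀ i₀ i₁ j₀ j₁ k d → i₀ + j₀ + (i₁ + (j₁ + k)) * d ≡ i₀ + i₁ * d + (j₀ + j₁ * d) + k * d
      regroup = solve-∀


open import Defs
open import Data.Nat using (zero; _≤_; NonZero)
open import Data.Nat.DivMod using (m≡m%n+[m/n]*n; m%n<n)
import Data.Nat.DivMod as ℕ
open import Data.Nat.Divisibility using (_∣_; divides)
open import Data.Fin using (Fin)
open import Data.Integer using (+_)
open import Data.Rational using (_/_)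
open import Data.Product using (∃; _×_; _,_)
open import Function.Bundles using (_↔_)
open import Relation.Binary.PropositionalEquality using (refl; trans; cong)
open Counting using (sumBelow)
open Rationals using (ι)

theorem1p3 : (d n i j k ℓ α β : ℕ) → .{{_ : NonZero d}} → 1 ≤ n → d ∣ k → 1 ≤ ℓ →
             i + j + k ≡ α * d + β → β < d →
             ∃ λ (N : ℕ) → (Pair d n i j k ℓ ↔ Fin N) × ((+ N) / 1 ≡ formula d n ℓ α β)
theorem1p3 zero     n i j k               ℓ        α β {{()}}
theorem1p3 (suc d′) n i j .(k′ * suc d′) (suc ℓ′) α β _ (divides k′ refl) _ i+j+k≡ β<d =
  sumBelow (suc d′) count , pairs-↔ , trans (cong ι (sumBelow-count β<d i+j+k≡)) (formula-value α β β<d)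
  where
  open Pairs d′ n k′ ℓ′ {i₁ = i ℕ./ suc d′} {j₁ = j ℕ./ suc d′}
             (m%n<n i (suc d′)) (m%n<n j (suc d′)) (m≡m%n+[m/n]*n i (suc d′)) (m≡m%n+[m/n]*n j (suc d′))
  open Formula d′ n ℓ′ using (formula-value)
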